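{- For every integer $n\ge 1$ define $$S(n)=\sum_{k\ge1}\sum_{N\ge1} f(k,N)\,g(n-k,N).$$ Then, as formal power series in $q$, $$\sum_{n\ge1}S(n)q^n=\sum_{n\ge1}\left(\frac{1}{(q;q)_{\infty}}-\frac{1}{(q;q)_n}\right)\sum_{i=1}^{n}\frac{q^{i}}{1-q^i}=\sum_{n\ge1}\Big(p_2(n)-n\,p(n)-\tfrac{1}{2}N_2(n)\Big)q^n.$$
   Context: $(a;q)_n=\prod_{k=0}^{n-1}(1-aq^k)$ and $(a;q)_\infty=\prod_{k\ge0}(1-aq^k)$. $p(n)$ is the number of (unrestricted) partitions of $n$, with $p(0)=1$. $p(m,n)$ is the number of partitions of $n$ with exactly $m$ parts, and $p_2(n)=\sum_{m}m^2p(m,n)$. The rank of a partition is its largest part minus its number of parts; $N(m,n)$ is the number of partitions of $n$ with rank $m$, and $N_2(n)=\sum_{m\in\mathbb{Z}}m^2N(m,n)$ is the second Atkin–Garvan rank moment. For integers $k\ge0$, $N\ge1$, $f(k,N)$ is $p(k)$ minus the number of partitions of $k$ all of whose parts are $\le N$ (equivalently, the coefficient of $q^k$ in $1/(q;q)_\infty-1/(q;q)_N$). For integers $m$ and $N\ge1$, $g(m,N)$ is the number of positive divisors $d\le N$ of $m$ when $m\ge1$, and $g(m,N)=0$ when $m\le 0$ (equivalently, $g(m,N)$ is the coefficient of $q^m$ in $\sum_{i=1}^N q^i/(1-q^i)$). -}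

module Defs where

open import Data.Nat as ℕ using (ℕ; zero; suc; _∸_; _⊓_; _≤?_)
open import Data.Nat.Divisibility using (_∣?_)
open import Data.Integer as ℤ using (ℤ; +_; -[1+_]; _-_; _*_; _+_)
open import Data.List using (List; []; _∷_; [_]; map; concatMap; length; filter; upTo; foldr; head)
open import Data.Maybe using (Maybe; just; nothing)
open import Relation.Nullary.Decidable using (Dec; yes; no)
open import Relation.Binary.PropositionalEquality using (_≡_)

range : ℕ → ℕ → List ℕ
range a b = map (a ℕ.+_) (upTo (suc b ∸ a))

sumℤ : List ℕ → (ℕ → ℤ) → ℤ
sumℤ xs f = foldr (λ x acc → f x + acc) (+ 0) xs

-- Partitions, as weakly decreasing lists of positive parts.
-- partsF fuel n b : all partitions of n whose largest part is ≤ b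
-- (fuel ≥ n suffices, since each step removes a positive part).

partsF : ℕ → ℕ → ℕ → List (List ℕ)
partsF _ zero _ = [ [] ]
partsF zero (suc n) _ = []
partsF (suc f) (suc n) b =
  concatMap (λ k → map (k ∷_) (partsF f (suc n ∸ k) k)) (range 1 (b ⊓ suc n))

partitions : ℕ → List (List ℕ)
partitions n = partsF n n n

p : ℕ → ℕ
p n = length (partitions n)

largest : List ℕ → ℕ
largest [] = 0
largest (x ∷ _) = x

pLe : ℕ → ℕ → ℕ
pLe N n = length (filter (λ λs → largest λs ≤? N) (partitions n))

f : ℕ → ℕ → ℤ
f k N = + p k - + pLe N k

g : ℤ → ℕ → ℤ
g (+ zero) N = + 0
g (+ suc m) N = + length (filter (λ d → d ∣? suc m) (range 1 N))
g -[1+ _ ] N = + 0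

pmn : ℕ → ℕ → ℕ
pmn m n = length (filter (λ λs → length λs ℕ.≟ m) (partitions n))

-- p₂(n) = Σ_m m² p(m,n)   (m ranges over 0..n, outside which p(m,n)=0)
p₂ : ℕ → ℤ
p₂ n = sumℤ (range 0 n) (λ m → + (m ℕ.* m ℕ.* pmn m n))

rank : List ℕ → ℤ
rank λs = + largest λs - + length λs

Nrank : ℤ → ℕ → ℕ
Nrank m n = length (filter (λ λs → rank λs ℤ.≟ m) (partitions n))

-- N₂(n) = Σ_{m∈ℤ} m² N(m,n)   (m ranges over -n..n, outside which N(m,n)=0)
N₂ : ℕ → ℤ
N₂ n = sumℤ (range 0 (n ℕ.+ n)) (λ j → let m = + j - + n in m * m * + Nrank m n)

-- S(n) = Σ_{k≥1} Σ_{N≥1} f(k,N) g(n-k,N).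
-- Terms with k > n vanish (g(n-k,N)=0) and terms with N ≥ k vanish
-- (f(k,N)=0), so summing k, N over 1..n captures every nonzero term.
S : ℕ → ℤ
S n = sumℤ (range 1 n) (λ k → sumℤ (range 1 n) (λ N → f k N * g (+ n - + k) N))

-- Coefficient sequences (ℕ → ℤ) viewed as formal power series in q.
Series : Set
Series = ℕ → ℤ

_⊛_ : Series → Series → Series
(a ⊛ b) n = sumℤ (range 0 n) (λ k → a k * b (n ∸ k))

-- 1/(q;q)_∞ : coefficient p(k)
invPochInf : Series
invPochInf k = + p k

-- 1/(q;q)_N : coefficient = # partitions of k with parts ≤ N
invPoch : ℕ → Series
invPoch N k = + pLe N k

-- Σ_{i=1}^N q^i/(1-q^i) : coefficient of q^m = # divisors i ≤ N of m (m ≥ 1)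
lambert : ℕ → Series
lambert N m = sumℤ (range 1 N) (λ i → geomCoeff i m)
  where
  geomCoeff : ℕ → ℕ → ℤ
  geomCoeff i zero = + 0
  geomCoeff i (suc m) with i ∣? suc m
  ... | yes _ = + 1
  ... | no _ = + 0

-- coefficient of q^n in Σ_{N≥1} (1/(q;q)_∞ - 1/(q;q)_N) Σ_{i=1}^N q^i/(1-q^i).
-- The N-th summand is O(q^{N+2}), so only N ≤ n contribute to q^n.
middleCoeff : ℕ → ℤ
middleCoeff n = sumℤ (range 1 n) (λ N → ((λ k → invPochInf k - invPoch N k) ⊛ lambert N) n)

-- Everything is reduced to sums over the partitions λ of n, with largest part L
-- and ℓ parts. In S(n), f(k, N) g(n − k, N) counts pairs of a partition of k
-- with largest part L > N and a divisor d ≤ N of n − k; summing over N weights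
-- such a pair by L − d, and adding j = (n − k)/d copies of d yields a partition
-- of n in which d < L occurs at least j times. Hence
-- S(n) = Σ_λ Σ_{parts x} (L − x) = Σ_λ (L ℓ − n).
-- Now 2 (L ℓ − n) = ℓ² + L² − 2n − (L − ℓ)², and conjugation (the number of
-- partitions fitting in an a × c box is symmetric in a and c) gives
-- Σ_λ L² = Σ_λ ℓ² = p₂(n), while Σ_λ (L − ℓ)² = N₂(n). The q-series identity is
-- coefficient extraction: q^m has coefficient g(m, N) in Σ_{i ≤ N} q^i/(1 − q^i).

module Submission where

open import Defs
open import Data.Nat using (ℕ; _≥_)
open import Data.Integer using (+_; _-_; _*_)
open import Data.Product using (_×_)
open import Relation.Binary.PropositionalEquality using (_≡_)

open import Data.Bool using (true; false; if_then_else_)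
open import Data.Empty using (⊥-elim)
open import Data.Integer as ℤ using (ℤ; _+_; -_)
import Data.Integer.Properties as ℤ
open import Data.Integer.Tactic.RingSolver using (solve-∀)
open import Algebra.Properties.AbelianGroup ℤ.+-0-abelianGroup using (∙-cancelˡ; ∙-cancelʳ)
open import Data.List using (List; []; _∷_; map; concatMap; length; filter; upTo; applyUpTo; foldr; _++_)
open import Data.List.Properties using (concatMap-cong; concatMap-map; foldr-cong)
open import Data.Nat as ℕ using (zero; suc; _∸_; _⊓_; _≤?_; _≤_; _<_; z≤n; s≤s; z<s)
open import Data.Nat.Divisibility using (_∣_; _∣?_; ∣m+n∣m⇒∣n; ∣m∣n⇒∣m+n; >⇒∤; ∣-refl)
import Data.Nat.Properties as ℕ
open import Data.Nat.Induction using (<-rec)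
open import Data.Product using (_,_)
open import Function using (_∘_)
open import Relation.Binary.PropositionalEquality using (refl; sym; trans; cong; cong₂; subst; module ≡-Reasoning)
open import Relation.Nullary using (¬_)
open import Relation.Nullary.Decidable using (Dec; yes; no; does; _×-dec_)

open ≡-Reasoning

-- Finite sums

∑ : ℕ → (ℕ → ℤ) → ℤ
∑ zero    h = + 0
∑ (suc m) h = h 0 + ∑ m (h ∘ suc)

infixl 10 ∑
syntax ∑ m (λ i → e) = ∑[ i < m ] e

∑-cong : ∀ m {h h′ : ℕ → ℤ} → (∀ i → i < m → h i ≡ h′ i) → ∑ m h ≡ ∑ m h′
∑-cong zero    eq = refl
∑-cong (suc m) eq = cong₂ _+_ (eq 0 (s≤s z≤n)) (∑-cong m (λ i i<m → eq (suc i) (s≤s i<m)))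

∑-zero : ∀ m {h : ℕ → ℤ} → (∀ i → i < m → h i ≡ + 0) → ∑ m h ≡ + 0
∑-zero zero    eq = refl
∑-zero (suc m) eq = cong₂ _+_ (eq 0 (s≤s z≤n)) (∑-zero m (λ i i<m → eq (suc i) (s≤s i<m)))

∑-distrib-+ : ∀ m (h h′ : ℕ → ℤ) → ∑[ i < m ] (h i + h′ i) ≡ ∑ m h + ∑ m h′
∑-distrib-+ zero    h h′ = refl
∑-distrib-+ (suc m) h h′ = trans (cong (_+_ (h 0 + h′ 0)) (∑-distrib-+ m (h ∘ suc) (h′ ∘ suc))) (interchange (h 0) (h′ 0) _ _)
  where
  interchange : ∀ a b c d → (a + b) + (c + d) ≡ (a + c) + (b + d)
  interchange = solve-∀

*-distribˡ-∑ : ∀ m c (h : ℕ → ℤ) → c * ∑ m h ≡ ∑[ i < m ] (c * h i)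
*-distribˡ-∑ zero    c h = ℤ.*-zeroʳ c
*-distribˡ-∑ (suc m) c h = trans (ℤ.*-distribˡ-+ c (h 0) _) (cong (_+_ (c * h 0)) (*-distribˡ-∑ m c (h ∘ suc)))

*-distribʳ-∑ : ∀ m c (h : ℕ → ℤ) → ∑ m h * c ≡ ∑[ i < m ] (h i * c)
*-distribʳ-∑ m c h = trans (ℤ.*-comm (∑ m h) c) (trans (*-distribˡ-∑ m c h) (∑-cong m (λ i _ → ℤ.*-comm c (h i))))

∑-*-∑ : ∀ m (h h′ : ℕ → ℤ) → ∑ m h * ∑ m h′ ≡ ∑[ i < m ] ∑[ j < m ] (h i * h′ j)
∑-*-∑ m h h′ = trans (*-distribʳ-∑ m (∑ m h′) h) (∑-cong m (λ i _ → *-distribˡ-∑ m (h i) h′))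

∑-split : ∀ a b (h : ℕ → ℤ) → ∑ (a ℕ.+ b) h ≡ ∑ a h + ∑[ i < b ] h (a ℕ.+ i)
∑-split zero    b h = sym (ℤ.+-identityˡ _)
∑-split (suc a) b h = trans (cong (_+_ (h 0)) (∑-split a b (h ∘ suc))) (sym (ℤ.+-assoc (h 0) _ _))

∑-last : ∀ m (h : ℕ → ℤ) → ∑ (suc m) h ≡ ∑ m h + h m
∑-last m h = begin
  ∑ (suc m) h                   ≡⟨ cong (λ k → ∑ k h) (ℕ.+-comm 1 m) ⟩
  ∑ (m ℕ.+ 1) h                 ≡⟨ ∑-split m 1 h ⟩
  ∑ m h + (h (m ℕ.+ 0) + + 0)   ≡⟨ cong (_+_ (∑ m h)) (trans (ℤ.+-identityʳ _) (cong h (ℕ.+-identityʳ m))) ⟩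
  ∑ m h + h m                   ∎

∑-comm : ∀ m k (h : ℕ → ℕ → ℤ) → ∑[ i < m ] ∑[ j < k ] h i j ≡ ∑[ j < k ] ∑[ i < m ] h i j
∑-comm zero    k h = sym (∑-zero k (λ _ _ → refl))
∑-comm (suc m) k h = trans (cong (_+_ (∑ k (h 0))) (∑-comm m k (h ∘ suc))) (sym (∑-distrib-+ k (h 0) _))

∑-comm² : ∀ m k (h : ℕ → ℕ → ℕ → ℕ → ℤ) →
  ∑[ a < m ] ∑[ c < m ] ∑[ i < k ] ∑[ e < k ] h a c i e ≡ ∑[ i < k ] ∑[ e < k ] ∑[ a < m ] ∑[ c < m ] h a c i e
∑-comm² m k h = begin
  ∑[ a < m ] ∑[ c < m ] ∑[ i < k ] ∑[ e < k ] h a c i e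
    ≡⟨ ∑-cong m (λ a _ → ∑-comm m k (λ c i → ∑[ e < k ] h a c i e)) ⟩
  ∑[ a < m ] ∑[ i < k ] ∑[ c < m ] ∑[ e < k ] h a c i e
    ≡⟨ ∑-cong m (λ a _ → ∑-cong k (λ i _ → ∑-comm m k (λ c e → h a c i e))) ⟩
  ∑[ a < m ] ∑[ i < k ] ∑[ e < k ] ∑[ c < m ] h a c i e
    ≡⟨ ∑-comm m k (λ a i → ∑[ e < k ] ∑[ c < m ] h a c i e) ⟩
  ∑[ i < k ] ∑[ a < m ] ∑[ e < k ] ∑[ c < m ] h a c i e
    ≡⟨ ∑-cong k (λ i _ → ∑-comm m k (λ a e → ∑[ c < m ] h a c i e)) ⟩
  ∑[ i < k ] ∑[ e < k ] ∑[ a < m ] ∑[ c < m ] h a c i e ∎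

∑-const-1 : ∀ m → ∑[ i < m ] (+ 1) ≡ + m
∑-const-1 zero    = refl
∑-const-1 (suc m) = cong (_+_ (+ 1)) (∑-const-1 m)

∑-drop : ∀ c r (h : ℕ → ℤ) → c ≤ r → (∀ i → i < c → h i ≡ + 0) → ∑ r h ≡ ∑[ i < r ∸ c ] h (c ℕ.+ i)
∑-drop c r h c≤r vanish = begin
  ∑ r h                                      ≡⟨ cong (λ k → ∑ k h) (sym (ℕ.m+[n∸m]≡n c≤r)) ⟩
  ∑ (c ℕ.+ (r ∸ c)) h                        ≡⟨ ∑-split c (r ∸ c) h ⟩
  ∑ c h + ∑[ i < r ∸ c ] h (c ℕ.+ i)         ≡⟨ cong (λ z → z + ∑[ i < r ∸ c ] h (c ℕ.+ i)) (∑-zero c vanish) ⟩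
  + 0 + ∑[ i < r ∸ c ] h (c ℕ.+ i)           ≡⟨ ℤ.+-identityˡ _ ⟩
  ∑[ i < r ∸ c ] h (c ℕ.+ i)                 ∎

∑-truncate : ∀ a n (h : ℕ → ℤ) → a ≤ n → (∀ i → a ≤ i → i < n → h i ≡ + 0) → ∑ n h ≡ ∑ a h
∑-truncate a n h a≤n vanish = begin
  ∑ n h                                  ≡⟨ cong (λ k → ∑ k h) (sym (ℕ.m+[n∸m]≡n a≤n)) ⟩
  ∑ (a ℕ.+ (n ∸ a)) h                    ≡⟨ ∑-split a (n ∸ a) h ⟩
  ∑ a h + ∑[ i < n ∸ a ] h (a ℕ.+ i)     ≡⟨ cong (_+_ (∑ a h)) (∑-zero (n ∸ a) tail-vanishes) ⟩
  ∑ a h + + 0                            ≡⟨ ℤ.+-identityʳ _ ⟩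
  ∑ a h                                  ∎
  where
  tail-vanishes : ∀ i → i < n ∸ a → h (a ℕ.+ i) ≡ + 0
  tail-vanishes i i<n∸a = vanish (a ℕ.+ i) (ℕ.m≤m+n a i)
    (subst (a ℕ.+ i <_) (ℕ.m+[n∸m]≡n a≤n) (ℕ.+-monoʳ-< a i<n∸a))

𝟙 : ∀ {a} {A : Set a} → Dec A → ℤ
𝟙 d = if does d then + 1 else + 0

𝟙-yes : ∀ {a} {A : Set a} (d : Dec A) → A → 𝟙 d ≡ + 1
𝟙-yes (yes _) _ = refl
𝟙-yes (no ¬a) a = ⊥-elim (¬a a)

𝟙-no : ∀ {a} {A : Set a} (d : Dec A) → ¬ A → 𝟙 d ≡ + 0
𝟙-no (yes a) ¬a = ⊥-elim (¬a a)
𝟙-no (no _)  _  = refl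

𝟙-⇔ : ∀ {a b} {A : Set a} {B : Set b} (da : Dec A) (db : Dec B) → (A → B) → (B → A) → 𝟙 da ≡ 𝟙 db
𝟙-⇔ (yes a) db to from = sym (𝟙-yes db (to a))
𝟙-⇔ (no ¬a) db to from = sym (𝟙-no db (¬a ∘ from))

𝟙-× : ∀ {a b} {A : Set a} {B : Set b} (da : Dec A) (db : Dec B) x → 𝟙 da * (𝟙 db * x) ≡ 𝟙 (da ×-dec db) * x
𝟙-× (yes _) (yes _) x = ℤ.*-identityˡ (+ 1 * x)
𝟙-× (yes _) (no _)  x = ℤ.*-identityˡ (+ 0 * x)
𝟙-× (no _)  db      x = trans (ℤ.*-zeroˡ (𝟙 db * x)) (sym (ℤ.*-zeroˡ x))

𝟙-*-cong : ∀ {a} {A : Set a} (d : Dec A) {x y : ℤ} → (A → x ≡ y) → 𝟙 d * x ≡ 𝟙 d * y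
𝟙-*-cong (yes a) eq = cong (+ 1 *_) (eq a)
𝟙-*-cong (no _)  eq = refl

𝟙-≤-∸ : ∀ n x y (h : ℕ → ℤ) → 𝟙 (x ≤? n) * (𝟙 (y ≤? n ∸ x) * h (n ∸ x ∸ y)) ≡ 𝟙 (x ℕ.+ y ≤? n) * h (n ∸ (x ℕ.+ y))
𝟙-≤-∸ n x y h = begin
  𝟙 (x ≤? n) * (𝟙 (y ≤? n ∸ x) * h (n ∸ x ∸ y))    ≡⟨ 𝟙-× (x ≤? n) (y ≤? n ∸ x) (h (n ∸ x ∸ y)) ⟩
  𝟙 ((x ≤? n) ×-dec (y ≤? n ∸ x)) * h (n ∸ x ∸ y)  ≡⟨ cong₂ _*_ (𝟙-⇔ ((x ≤? n) ×-dec (y ≤? n ∸ x)) (x ℕ.+ y ≤? n) join split)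
                                                                (cong h (ℕ.∸-+-assoc n x y)) ⟩
  𝟙 (x ℕ.+ y ≤? n) * h (n ∸ (x ℕ.+ y))             ∎
  where
  join : x ≤ n × y ≤ n ∸ x → x ℕ.+ y ≤ n
  join (x≤n , y≤n∸x) = ℕ.≤-trans (ℕ.+-monoʳ-≤ x y≤n∸x) (ℕ.≤-reflexive (ℕ.m+[n∸m]≡n x≤n))
  split : x ℕ.+ y ≤ n → x ≤ n × y ≤ n ∸ x
  split x+y≤n = ℕ.m+n≤o⇒m≤o x x+y≤n , subst (_≤ n ∸ x) (ℕ.m+n∸m≡n x y) (ℕ.∸-monoˡ-≤ x x+y≤n)

∑-pick : ∀ m (h : ℕ → ℤ) c → c < m → ∑[ j < m ] (h j * 𝟙 (c ℕ.≟ j)) ≡ h c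
∑-pick (suc m) h zero _ = begin
  h 0 * + 1 + ∑[ j < m ] (h (suc j) * 𝟙 (0 ℕ.≟ suc j))   ≡⟨ cong₂ _+_ (ℤ.*-identityʳ (h 0)) (∑-zero m rest) ⟩
  h 0 + + 0                                               ≡⟨ ℤ.+-identityʳ (h 0) ⟩
  h 0                                                     ∎
  where
  rest : ∀ j → j < m → h (suc j) * 𝟙 (0 ℕ.≟ suc j) ≡ + 0
  rest j _ = trans (cong (h (suc j) *_) (𝟙-no (0 ℕ.≟ suc j) λ ())) (ℤ.*-zeroʳ (h (suc j)))
∑-pick (suc m) h (suc c) (s≤s c<m) = begin
  h 0 * 𝟙 (suc c ℕ.≟ 0) + ∑[ j < m ] (h (suc j) * 𝟙 (suc c ℕ.≟ suc j))
    ≡⟨ cong₂ _+_ (trans (cong (h 0 *_) (𝟙-no (suc c ℕ.≟ 0) λ ())) (ℤ.*-zeroʳ (h 0))) (∑-cong m shift) ⟩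
  + 0 + ∑[ j < m ] (h (suc j) * 𝟙 (c ℕ.≟ j))
    ≡⟨ trans (ℤ.+-identityˡ _) (∑-pick m (h ∘ suc) c c<m) ⟩
  h (suc c) ∎
  where
  shift : ∀ j → j < m → h (suc j) * 𝟙 (suc c ℕ.≟ suc j) ≡ h (suc j) * 𝟙 (c ℕ.≟ j)
  shift j _ = cong (h (suc j) *_) (𝟙-⇔ (suc c ℕ.≟ suc j) (c ℕ.≟ j) ℕ.suc-injective (cong suc))

∑-restrict : ∀ a n (h : ℕ → ℤ) {P : ℕ → Set} (P? : ∀ i → Dec (P i)) → a ≤ n →
  (∀ i → i < a → P i) → (∀ i → a ≤ i → i < n → ¬ P i) → ∑[ i < n ] (𝟙 (P? i) * h i) ≡ ∑ a h
∑-restrict a n h P? a≤n inside outside = begin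
  ∑[ i < n ] (𝟙 (P? i) * h i)
    ≡⟨ ∑-truncate a n _ a≤n (λ i a≤i i<n → trans (cong (_* h i) (𝟙-no (P? i) (outside i a≤i i<n))) (ℤ.*-zeroˡ (h i))) ⟩
  ∑[ i < a ] (𝟙 (P? i) * h i)
    ≡⟨ ∑-cong a (λ i i<a → trans (cong (_* h i) (𝟙-yes (P? i) (inside i i<a))) (ℤ.*-identityˡ (h i))) ⟩
  ∑ a h ∎

∑ₗ : ∀ {a} {A : Set a} → List A → (A → ℤ) → ℤ
∑ₗ xs w = foldr (λ x acc → w x + acc) (+ 0) xs

infixl 10 ∑ₗ
syntax ∑ₗ xs (λ x → e) = ∑[ x ∈ xs ] e

module _ {a} {A : Set a} where

  ∑ₗ-cong : ∀ xs {w w′ : A → ℤ} → (∀ x → w x ≡ w′ x) → ∑ₗ xs w ≡ ∑ₗ xs w′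
  ∑ₗ-cong []       eq = refl
  ∑ₗ-cong (x ∷ xs) eq = cong₂ _+_ (eq x) (∑ₗ-cong xs eq)

  ∑ₗ-zero : ∀ xs {w : A → ℤ} → (∀ x → w x ≡ + 0) → ∑ₗ xs w ≡ + 0
  ∑ₗ-zero []       eq = refl
  ∑ₗ-zero (x ∷ xs) eq = cong₂ _+_ (eq x) (∑ₗ-zero xs eq)

  ∑ₗ-distrib-+ : ∀ xs (w w′ : A → ℤ) → ∑[ x ∈ xs ] (w x + w′ x) ≡ ∑ₗ xs w + ∑ₗ xs w′
  ∑ₗ-distrib-+ []       w w′ = refl
  ∑ₗ-distrib-+ (x ∷ xs) w w′ = trans (cong (_+_ (w x + w′ x)) (∑ₗ-distrib-+ xs w w′)) (interchange (w x) (w′ x) _ _)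
    where
    interchange : ∀ a b c d → (a + b) + (c + d) ≡ (a + c) + (b + d)
    interchange = solve-∀

  ∑ₗ-distrib-- : ∀ xs (w w′ : A → ℤ) → ∑[ x ∈ xs ] (w x - w′ x) ≡ ∑ₗ xs w - ∑ₗ xs w′
  ∑ₗ-distrib-- []       w w′ = refl
  ∑ₗ-distrib-- (x ∷ xs) w w′ = trans (cong (_+_ (w x - w′ x)) (∑ₗ-distrib-- xs w w′)) (interchange (w x) (w′ x) _ _)
    where
    interchange : ∀ a b c d → (a - b) + (c - d) ≡ (a + c) - (b + d)
    interchange = solve-∀

  *-distribˡ-∑ₗ : ∀ c xs (w : A → ℤ) → c * ∑ₗ xs w ≡ ∑[ x ∈ xs ] (c * w x)
  *-distribˡ-∑ₗ c []       w = ℤ.*-zeroʳ c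
  *-distribˡ-∑ₗ c (x ∷ xs) w = trans (ℤ.*-distribˡ-+ c (w x) _) (cong (_+_ (c * w x)) (*-distribˡ-∑ₗ c xs w))

  ∑ₗ-const : ∀ c (xs : List A) → ∑[ x ∈ xs ] c ≡ c * + length xs
  ∑ₗ-const c []       = sym (ℤ.*-zeroʳ c)
  ∑ₗ-const c (x ∷ xs) = begin
    c + ∑[ x ∈ xs ] c        ≡⟨ cong (_+_ c) (∑ₗ-const c xs) ⟩
    c + c * + length xs      ≡⟨ cong (_+ c * + length xs) (sym (ℤ.*-identityʳ c)) ⟩
    c * + 1 + c * + length xs ≡⟨ sym (ℤ.*-distribˡ-+ c (+ 1) (+ length xs)) ⟩
    c * + length (x ∷ xs)    ∎

  ∑ₗ-++ : ∀ xs ys (w : A → ℤ) → ∑ₗ (xs ++ ys) w ≡ ∑ₗ xs w + ∑ₗ ys w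
  ∑ₗ-++ []       ys w = sym (ℤ.+-identityˡ _)
  ∑ₗ-++ (x ∷ xs) ys w = trans (cong (_+_ (w x)) (∑ₗ-++ xs ys w)) (sym (ℤ.+-assoc (w x) _ _))

  ∑ₗ-1 : ∀ (xs : List A) → ∑[ x ∈ xs ] (+ 1) ≡ + length xs
  ∑ₗ-1 xs = trans (∑ₗ-const (+ 1) xs) (ℤ.*-identityˡ (+ length xs))

  ∑ₗ-comm-∑ : ∀ xs m (h : A → ℕ → ℤ) → ∑[ x ∈ xs ] ∑[ i < m ] h x i ≡ ∑[ i < m ] ∑[ x ∈ xs ] h x i
  ∑ₗ-comm-∑ []       m h = sym (∑-zero m (λ _ _ → refl))
  ∑ₗ-comm-∑ (x ∷ xs) m h = trans (cong (_+_ (∑ m (h x))) (∑ₗ-comm-∑ xs m h)) (sym (∑-distrib-+ m (h x) _))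

  length-filter : ∀ {p} {P : A → Set p} (P? : ∀ x → Dec (P x)) xs → + length (filter P? xs) ≡ ∑[ x ∈ xs ] 𝟙 (P? x)
  length-filter P? []       = refl
  length-filter P? (x ∷ xs) with does (P? x)
  ... | true  = cong (_+_ (+ 1)) (length-filter P? xs)
  ... | false = trans (length-filter P? xs) (sym (ℤ.+-identityˡ _))

∑ₗ-map : ∀ {a b} {A : Set a} {B : Set b} (g : A → B) xs (w : B → ℤ) → ∑ₗ (map g xs) w ≡ ∑[ x ∈ xs ] w (g x)
∑ₗ-map g []       w = refl
∑ₗ-map g (x ∷ xs) w = cong (_+_ (w (g x))) (∑ₗ-map g xs w)

∑ₗ-concatMap : ∀ {a b} {A : Set a} {B : Set b} (h : A → List B) xs (w : B → ℤ) →
  ∑ₗ (concatMap h xs) w ≡ ∑[ x ∈ xs ] ∑ₗ (h x) w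
∑ₗ-concatMap h []       w = refl
∑ₗ-concatMap h (x ∷ xs) w = trans (∑ₗ-++ (h x) (concatMap h xs) w) (cong (_+_ (∑ₗ (h x) w)) (∑ₗ-concatMap h xs w))

∑ₗ-applyUpTo : ∀ {a} {A : Set a} (f : ℕ → A) m (w : A → ℤ) → ∑ₗ (applyUpTo f m) w ≡ ∑[ i < m ] w (f i)
∑ₗ-applyUpTo f zero    w = refl
∑ₗ-applyUpTo f (suc m) w = cong (_+_ (w (f 0))) (∑ₗ-applyUpTo (f ∘ suc) m w)

sumℤ-range : ∀ a b (h : ℕ → ℤ) → sumℤ (range a b) h ≡ ∑[ i < suc b ∸ a ] h (a ℕ.+ i)
sumℤ-range a b h = trans (∑ₗ-map (a ℕ.+_) (upTo (suc b ∸ a)) h) (∑ₗ-applyUpTo (λ i → i) (suc b ∸ a) (h ∘ (a ℕ.+_)))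

-- Partitions with bounded parts

partsLe : ℕ → ℕ → List (List ℕ)
partsLe n b = partsF n n b

pBounded : ℕ → ℕ → ℤ
pBounded n b = + length (partsLe n b)

partsF-fuel : ∀ f f′ n b → n ≤ f → n ≤ f′ → partsF f n b ≡ partsF f′ n b
partsF-fuel f       f′       zero    b _         _          = refl
partsF-fuel (suc f) (suc f′) (suc n) b (s≤s n≤f) (s≤s n≤f′) = begin
  concatMap (byLargest f) (map suc ks)   ≡⟨ concatMap-map (byLargest f) suc ks ⟩
  concatMap (byLargest f ∘ suc) ks       ≡⟨ concatMap-cong (λ i → cong (map (suc i ∷_)) (rest i)) ks ⟩
  concatMap (byLargest f′ ∘ suc) ks      ≡⟨ sym (concatMap-map (byLargest f′) suc ks) ⟩
  concatMap (byLargest f′) (map suc ks)  ∎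
  where
  ks = upTo (b ⊓ suc n)
  byLargest : ℕ → ℕ → List (List ℕ)
  byLargest g k = map (k ∷_) (partsF g (suc n ∸ k) k)
  rest : ∀ i → partsF f (n ∸ i) (suc i) ≡ partsF f′ (n ∸ i) (suc i)
  rest i = partsF-fuel f f′ (n ∸ i) (suc i) (ℕ.≤-trans (ℕ.m∸n≤m n i) n≤f) (ℕ.≤-trans (ℕ.m∸n≤m n i) n≤f′)

∑-partsLe-suc : ∀ n b (w : List ℕ → ℤ) →
  ∑ₗ (partsLe (suc n) b) w ≡ ∑[ i < b ⊓ suc n ] ∑[ ν ∈ partsLe (n ∸ i) (suc i) ] w (suc i ∷ ν)
∑-partsLe-suc n b w = begin
  ∑ₗ (concatMap byLargest (map suc (upTo (b ⊓ suc n)))) w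
    ≡⟨ ∑ₗ-concatMap byLargest (map suc (upTo (b ⊓ suc n))) w ⟩
  ∑[ k ∈ map suc (upTo (b ⊓ suc n)) ] ∑ₗ (byLargest k) w
    ≡⟨ ∑ₗ-map suc (upTo (b ⊓ suc n)) (λ k → ∑ₗ (byLargest k) w) ⟩
  ∑[ i ∈ upTo (b ⊓ suc n) ] ∑ₗ (byLargest (suc i)) w
    ≡⟨ ∑ₗ-applyUpTo (λ i → i) (b ⊓ suc n) _ ⟩
  ∑[ i < b ⊓ suc n ] ∑ₗ (byLargest (suc i)) w
    ≡⟨ ∑-cong (b ⊓ suc n) (λ i _ → trans (∑ₗ-map (suc i ∷_) (partsF n (n ∸ i) (suc i)) w) (cong (λ νs → ∑ₗ νs (w ∘ (suc i ∷_))) (fuel i))) ⟩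
  ∑[ i < b ⊓ suc n ] ∑[ ν ∈ partsLe (n ∸ i) (suc i) ] w (suc i ∷ ν) ∎
  where
  byLargest : ℕ → List (List ℕ)
  byLargest k = map (k ∷_) (partsF n (suc n ∸ k) k)
  fuel : ∀ i → partsF n (n ∸ i) (suc i) ≡ partsLe (n ∸ i) (suc i)
  fuel i = partsF-fuel n (n ∸ i) (n ∸ i) (suc i) (ℕ.m∸n≤m n i) ℕ.≤-refl

∑-partitions-suc : ∀ n (w : List ℕ → ℤ) →
  ∑ₗ (partitions (suc n)) w ≡ ∑[ i < suc n ] ∑[ ν ∈ partsLe (n ∸ i) (suc i) ] w (suc i ∷ ν)
∑-partitions-suc n w = trans (∑-partsLe-suc n (suc n) w)
  (cong (λ t → ∑[ i < t ] ∑[ ν ∈ partsLe (n ∸ i) (suc i) ] w (suc i ∷ ν)) (ℕ.⊓-idem (suc n)))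

partsLe-saturate : ∀ n b → n ≤ b → partsLe n b ≡ partsLe n n
partsLe-saturate zero    b _   = refl
partsLe-saturate (suc m) b n≤b = cong (λ t → concatMap (λ k → map (k ∷_) (partsF m (suc m ∸ k) k)) (map suc (upTo t)))
  (trans (ℕ.m≥n⇒m⊓n≡n n≤b) (sym (ℕ.⊓-idem (suc m))))

∑-partsLe-raise : ∀ n b (w : List ℕ → ℤ) →
  ∑ₗ (partsLe n (suc b)) w ≡ ∑ₗ (partsLe n b) w + 𝟙 (suc b ≤? n) * ∑[ ν ∈ partsLe (n ∸ suc b) (suc b) ] w (suc b ∷ ν)
∑-partsLe-raise n b w = raise (suc b ≤? n)
  where
  φ : ℕ → ℤ
  φ i = ∑[ ν ∈ partsLe (n ∸ suc i) (suc i) ] w (suc i ∷ ν)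
  newLargest : ∀ n → suc b ≤ n → ∑ₗ (partsLe n (suc b)) w ≡ ∑ₗ (partsLe n b) w + ∑[ ν ∈ partsLe (n ∸ suc b) (suc b) ] w (suc b ∷ ν)
  newLargest (suc m) (s≤s b≤m) = begin
    ∑ₗ (partsLe (suc m) (suc b)) w ≡⟨ ∑-partsLe-suc m (suc b) w ⟩
    ∑ (suc b ⊓ suc m) ψ            ≡⟨ cong (λ t → ∑ t ψ) (ℕ.m≤n⇒m⊓n≡m (s≤s b≤m)) ⟩
    ∑ (suc b) ψ                    ≡⟨ ∑-last b ψ ⟩
    ∑ b ψ + ψ b                    ≡⟨ cong (λ t → ∑ t ψ + ψ b) (sym (ℕ.m≤n⇒m⊓n≡m (ℕ.m≤n⇒m≤1+n b≤m))) ⟩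
    ∑ (b ⊓ suc m) ψ + ψ b          ≡⟨ cong (_+ ψ b) (sym (∑-partsLe-suc m b w)) ⟩
    ∑ₗ (partsLe (suc m) b) w + ψ b ∎
    where
    ψ : ℕ → ℤ
    ψ i = ∑[ ν ∈ partsLe (m ∸ i) (suc i) ] w (suc i ∷ ν)
  raise : (d : Dec (suc b ≤ n)) → ∑ₗ (partsLe n (suc b)) w ≡ ∑ₗ (partsLe n b) w + 𝟙 d * φ b
  raise (yes b<n) = trans (newLargest n b<n) (cong (_+_ (∑ₗ (partsLe n b) w)) (sym (ℤ.*-identityˡ (φ b))))
  raise (no b≮n)  = begin
    ∑ₗ (partsLe n (suc b)) w  ≡⟨ cong (λ μs → ∑ₗ μs w) (trans (partsLe-saturate n (suc b) (ℕ.m≤n⇒m≤1+n n≤b)) (sym (partsLe-saturate n b n≤b))) ⟩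
    ∑ₗ (partsLe n b) w        ≡⟨ sym (ℤ.+-identityʳ _) ⟩
    ∑ₗ (partsLe n b) w + + 0  ≡⟨ cong (_+_ (∑ₗ (partsLe n b) w)) (sym (ℤ.*-zeroˡ (φ b))) ⟩
    ∑ₗ (partsLe n b) w + + 0 * φ b ∎
    where
    n≤b : n ≤ b
    n≤b = ℕ.≤-pred (ℕ.≰⇒> b≮n)

∑-partsLe-cong : ∀ n b {w w′ : List ℕ → ℤ} →
  (∀ μ → length μ ≤ n → largest μ ≤ n → w μ ≡ w′ μ) → ∑ₗ (partsLe n b) w ≡ ∑ₗ (partsLe n b) w′
∑-partsLe-cong = <-rec Claim claim
  where
  Claim : ℕ → Set
  Claim n = ∀ b {w w′ : List ℕ → ℤ} →
    (∀ μ → length μ ≤ n → largest μ ≤ n → w μ ≡ w′ μ) → ∑ₗ (partsLe n b) w ≡ ∑ₗ (partsLe n b) w′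
  claim : ∀ n → (∀ {k} → k < n → Claim k) → Claim n
  claim zero    _   b agree = cong (_+ + 0) (agree [] z≤n z≤n)
  claim (suc m) rec b {w} {w′} agree =
    trans (∑-partsLe-suc m b w) (trans (∑-cong (b ⊓ suc m) byLargest) (sym (∑-partsLe-suc m b w′)))
    where
    byLargest : ∀ i → i < b ⊓ suc m →
      ∑[ ν ∈ partsLe (m ∸ i) (suc i) ] w (suc i ∷ ν) ≡ ∑[ ν ∈ partsLe (m ∸ i) (suc i) ] w′ (suc i ∷ ν)
    byLargest i i<b⊓n = rec (s≤s (ℕ.m∸n≤m m i)) (suc i) λ ν len≤ _ →
      agree (suc i ∷ ν) (s≤s (ℕ.≤-trans len≤ (ℕ.m∸n≤m m i))) (ℕ.≤-trans i<b⊓n (ℕ.m⊓n≤n b (suc m)))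

-- Conjugation symmetry

𝟙-suc≤suc : ∀ l c → 𝟙 (suc l ≤? suc c) ≡ 𝟙 (l ≤? c)
𝟙-suc≤suc l c = 𝟙-⇔ (suc l ≤? suc c) (l ≤? c) ℕ.≤-pred s≤s

𝟙-suc≤0 : ∀ l → 𝟙 (suc l ≤? 0) ≡ + 0
𝟙-suc≤0 l = 𝟙-no (suc l ≤? 0) λ ()

𝟙-suc≟suc : ∀ l c → 𝟙 (suc l ℕ.≟ suc c) ≡ 𝟙 (l ℕ.≟ c)
𝟙-suc≟suc l c = 𝟙-⇔ (suc l ℕ.≟ suc c) (l ℕ.≟ c) ℕ.suc-injective (cong suc)

𝟙-suc≟0 : ∀ l → 𝟙 (suc l ℕ.≟ 0) ≡ + 0
𝟙-suc≟0 l = 𝟙-no (suc l ℕ.≟ 0) λ ()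

𝟙-≤-suc : ∀ l c → 𝟙 (l ≤? suc c) ≡ 𝟙 (l ≤? c) + 𝟙 (l ℕ.≟ suc c)
𝟙-≤-suc zero          c       = refl
𝟙-≤-suc (suc zero)    zero    = refl
𝟙-≤-suc (suc (suc l)) zero    = begin
  𝟙 (suc (suc l) ≤? 1)                      ≡⟨ trans (𝟙-suc≤suc (suc l) 0) (𝟙-suc≤0 l) ⟩
  + 0                                       ≡⟨ sym (cong₂ _+_ (𝟙-suc≤0 (suc l)) (trans (𝟙-suc≟suc (suc l) 0) (𝟙-suc≟0 l))) ⟩
  𝟙 (suc (suc l) ≤? 0) + 𝟙 (suc (suc l) ℕ.≟ 1) ∎
𝟙-≤-suc (suc l)       (suc c) = begin
  𝟙 (suc l ≤? suc (suc c))                          ≡⟨ 𝟙-suc≤suc l (suc c) ⟩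
  𝟙 (l ≤? suc c)                                    ≡⟨ 𝟙-≤-suc l c ⟩
  𝟙 (l ≤? c) + 𝟙 (l ℕ.≟ suc c)                      ≡⟨ sym (cong₂ _+_ (𝟙-suc≤suc l c) (𝟙-suc≟suc l (suc c))) ⟩
  𝟙 (suc l ≤? suc c) + 𝟙 (suc l ℕ.≟ suc (suc c))    ∎

𝟙-≟0 : ∀ l → 𝟙 (l ℕ.≟ 0) ≡ 𝟙 (l ≤? 0)
𝟙-≟0 zero    = refl
𝟙-≟0 (suc l) = trans (𝟙-suc≟0 l) (sym (𝟙-suc≤0 l))

pBox : ℕ → ℕ → ℕ → ℤ
pBox n a c = ∑[ μ ∈ partsLe n a ] 𝟙 (length μ ≤? c)

pExact : ℕ → ℕ → ℕ → ℤ
pExact n a c = ∑[ μ ∈ partsLe n a ] 𝟙 (length μ ℕ.≟ c)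

pBox-raiseLargest : ∀ n a c →
  pBox n (suc a) (suc c) ≡ pBox n a (suc c) + 𝟙 (suc a ≤? n) * pBox (n ∸ suc a) (suc a) c
pBox-raiseLargest n a c = trans (∑-partsLe-raise n a (λ μ → 𝟙 (length μ ≤? suc c)))
  (cong (λ t → pBox n a (suc c) + 𝟙 (suc a ≤? n) * t) (∑ₗ-cong (partsLe (n ∸ suc a) (suc a)) (λ ν → 𝟙-suc≤suc (length ν) c)))

pBox-raiseLargest-0 : ∀ n a → pBox n (suc a) 0 ≡ pBox n a 0
pBox-raiseLargest-0 n a = begin
  pBox n (suc a) 0                         ≡⟨ ∑-partsLe-raise n a (λ μ → 𝟙 (length μ ≤? 0)) ⟩
  pBox n a 0 + 𝟙 (suc a ≤? n) * _          ≡⟨ cong (λ t → pBox n a 0 + 𝟙 (suc a ≤? n) * t) (∑ₗ-zero (partsLe (n ∸ suc a) (suc a)) (𝟙-suc≤0 ∘ length)) ⟩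
  pBox n a 0 + 𝟙 (suc a ≤? n) * + 0        ≡⟨ trans (cong (_+_ (pBox n a 0)) (ℤ.*-zeroʳ (𝟙 (suc a ≤? n)))) (ℤ.+-identityʳ _) ⟩
  pBox n a 0                               ∎

pExact-raiseLargest : ∀ n a c →
  pExact n (suc a) (suc c) ≡ pExact n a (suc c) + 𝟙 (suc a ≤? n) * pExact (n ∸ suc a) (suc a) c
pExact-raiseLargest n a c = trans (∑-partsLe-raise n a (λ μ → 𝟙 (length μ ℕ.≟ suc c)))
  (cong (λ t → pExact n a (suc c) + 𝟙 (suc a ≤? n) * t) (∑ₗ-cong (partsLe (n ∸ suc a) (suc a)) (λ ν → 𝟙-suc≟suc (length ν) c)))

pExact-raiseLargest-0 : ∀ n a → pExact n (suc a) 0 ≡ pExact n a 0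
pExact-raiseLargest-0 n a = begin
  pExact n (suc a) 0                        ≡⟨ ∑-partsLe-raise n a (λ μ → 𝟙 (length μ ℕ.≟ 0)) ⟩
  pExact n a 0 + 𝟙 (suc a ≤? n) * _         ≡⟨ cong (λ t → pExact n a 0 + 𝟙 (suc a ≤? n) * t) (∑ₗ-zero (partsLe (n ∸ suc a) (suc a)) (𝟙-suc≟0 ∘ length)) ⟩
  pExact n a 0 + 𝟙 (suc a ≤? n) * + 0       ≡⟨ trans (cong (_+_ (pExact n a 0)) (ℤ.*-zeroʳ (𝟙 (suc a ≤? n)))) (ℤ.+-identityʳ _) ⟩
  pExact n a 0                              ∎

pBox-0 : ∀ n c c′ → pBox n 0 c ≡ pBox n 0 c′
pBox-0 zero    c c′ = refl
pBox-0 (suc n) c c′ = refl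

pBox-noParts : ∀ n a → pBox n a 0 ≡ pBox n 0 0
pBox-noParts n zero    = refl
pBox-noParts n (suc a) = trans (pBox-raiseLargest-0 n a) (pBox-noParts n a)

pExact-1 : ∀ n b → pExact n 1 b ≡ 𝟙 (b ≤? n) * pBox (n ∸ b) 0 b
pExact-1 zero    zero    = refl
pExact-1 zero    (suc b) = refl
pExact-1 (suc n) zero    = trans (∑-partsLe-raise (suc n) 0 (λ μ → 𝟙 (length μ ℕ.≟ 0)))
  (cong (λ t → pExact (suc n) 0 0 + 𝟙 (1 ≤? suc n) * t) (∑ₗ-zero (partsLe n 1) (𝟙-suc≟0 ∘ length)))
pExact-1 (suc n) (suc b) = begin
  pExact (suc n) 1 (suc b)
    ≡⟨ ∑-partsLe-raise (suc n) 0 (λ μ → 𝟙 (length μ ℕ.≟ suc b)) ⟩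
  + 0 + + 1 * ∑[ ν ∈ partsLe n 1 ] 𝟙 (suc (length ν) ℕ.≟ suc b)
    ≡⟨ trans (ℤ.+-identityˡ _) (ℤ.*-identityˡ _) ⟩
  ∑[ ν ∈ partsLe n 1 ] 𝟙 (suc (length ν) ℕ.≟ suc b)
    ≡⟨ ∑ₗ-cong (partsLe n 1) (λ ν → 𝟙-suc≟suc (length ν) b) ⟩
  pExact n 1 b
    ≡⟨ pExact-1 n b ⟩
  𝟙 (b ≤? n) * pBox (n ∸ b) 0 b
    ≡⟨ cong₂ _*_ (sym (𝟙-suc≤suc b n)) (pBox-0 (n ∸ b) b (suc b)) ⟩
  𝟙 (suc b ≤? suc n) * pBox (n ∸ b) 0 (suc b) ∎

-- Removing the first column: subtract one from each of the c parts.
pExact-suc : ∀ a n c → pExact n (suc a) c ≡ 𝟙 (c ≤? n) * pBox (n ∸ c) a c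
pExact-suc zero    = pExact-1
pExact-suc (suc a) = <-rec Claim claim
  where
  Claim : ℕ → Set
  Claim n = ∀ c → pExact n (suc (suc a)) c ≡ 𝟙 (c ≤? n) * pBox (n ∸ c) (suc a) c
  claim : ∀ n → (∀ {k} → k < n → Claim k) → Claim n
  claim n rec zero = begin
    pExact n (suc (suc a)) 0      ≡⟨ pExact-raiseLargest-0 n (suc a) ⟩
    pExact n (suc a) 0            ≡⟨ pExact-suc a n 0 ⟩
    𝟙 (0 ≤? n) * pBox n a 0       ≡⟨ cong (𝟙 (0 ≤? n) *_) (sym (pBox-raiseLargest-0 n a)) ⟩
    𝟙 (0 ≤? n) * pBox n (suc a) 0 ∎
  claim n rec (suc c) = begin
    pExact n (suc (suc a)) (suc c)
      ≡⟨ pExact-raiseLargest n (suc a) c ⟩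
    pExact n (suc a) (suc c) + 𝟙 (suc (suc a) ≤? n) * pExact (n ∸ suc (suc a)) (suc (suc a)) c
      ≡⟨ cong₂ _+_ (pExact-suc a n (suc c)) (𝟙-*-cong (suc (suc a) ≤? n) λ a+1<n → rec (ℕ.∸-monoʳ-< z<s a+1<n) c) ⟩
    𝟙 (suc c ≤? n) * pBox n′ a (suc c) + 𝟙 (suc (suc a) ≤? n) * (𝟙 (c ≤? n ∸ suc (suc a)) * pBox (n ∸ suc (suc a) ∸ c) (suc a) c)
      ≡⟨ cong (_+_ (𝟙 (suc c ≤? n) * pBox n′ a (suc c))) removeBoth ⟩
    𝟙 (suc c ≤? n) * pBox n′ a (suc c) + 𝟙 (suc c ≤? n) * (𝟙 (suc a ≤? n′) * pBox (n′ ∸ suc a) (suc a) c)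
      ≡⟨ sym (ℤ.*-distribˡ-+ (𝟙 (suc c ≤? n)) _ _) ⟩
    𝟙 (suc c ≤? n) * (pBox n′ a (suc c) + 𝟙 (suc a ≤? n′) * pBox (n′ ∸ suc a) (suc a) c)
      ≡⟨ cong (𝟙 (suc c ≤? n) *_) (sym (pBox-raiseLargest n′ a c)) ⟩
    𝟙 (suc c ≤? n) * pBox n′ (suc a) (suc c) ∎
    where
    n′ = n ∸ suc c
    box : ℕ → ℤ
    box t = pBox t (suc a) c
    removeBoth : 𝟙 (suc (suc a) ≤? n) * (𝟙 (c ≤? n ∸ suc (suc a)) * box (n ∸ suc (suc a) ∸ c)) ≡
                 𝟙 (suc c ≤? n) * (𝟙 (suc a ≤? n′) * box (n′ ∸ suc a))
    removeBoth = begin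
      𝟙 (suc (suc a) ≤? n) * (𝟙 (c ≤? n ∸ suc (suc a)) * box (n ∸ suc (suc a) ∸ c))  ≡⟨ 𝟙-≤-∸ n (suc (suc a)) c box ⟩
      𝟙 (suc (suc a) ℕ.+ c ≤? n) * box (n ∸ (suc (suc a) ℕ.+ c))                      ≡⟨ cong (λ t → 𝟙 (t ≤? n) * box (n ∸ t)) swap ⟩
      𝟙 (suc c ℕ.+ suc a ≤? n) * box (n ∸ (suc c ℕ.+ suc a))                          ≡⟨ 𝟙-≤-∸ n (suc c) (suc a) box ⟨
      𝟙 (suc c ≤? n) * (𝟙 (suc a ≤? n′) * box (n′ ∸ suc a))                           ∎
      where
      swap : suc (suc a) ℕ.+ c ≡ suc c ℕ.+ suc a
      swap = cong suc (trans (cong suc (ℕ.+-comm a c)) (sym (ℕ.+-suc c a)))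

pBox-raiseLength : ∀ n a c →
  pBox n (suc a) (suc c) ≡ pBox n (suc a) c + 𝟙 (suc c ≤? n) * pBox (n ∸ suc c) a (suc c)
pBox-raiseLength n a c = begin
  pBox n (suc a) (suc c)
    ≡⟨ ∑ₗ-cong (partsLe n (suc a)) (λ μ → 𝟙-≤-suc (length μ) c) ⟩
  ∑[ μ ∈ partsLe n (suc a) ] (𝟙 (length μ ≤? c) + 𝟙 (length μ ℕ.≟ suc c))
    ≡⟨ ∑ₗ-distrib-+ (partsLe n (suc a)) (λ μ → 𝟙 (length μ ≤? c)) (λ μ → 𝟙 (length μ ℕ.≟ suc c)) ⟩
  pBox n (suc a) c + pExact n (suc a) (suc c)
    ≡⟨ cong (_+_ (pBox n (suc a) c)) (pExact-suc a n (suc c)) ⟩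
  pBox n (suc a) c + 𝟙 (suc c ≤? n) * pBox (n ∸ suc c) a (suc c) ∎

pBox-sym : ∀ n a c → pBox n a c ≡ pBox n c a
pBox-sym n zero    zero    = refl
pBox-sym n zero    (suc c) = trans (pBox-0 n (suc c) 0) (sym (pBox-noParts n (suc c)))
pBox-sym n (suc a) zero    = trans (pBox-noParts n (suc a)) (pBox-0 n 0 (suc a))
pBox-sym n (suc a) (suc c) = begin
  pBox n (suc a) (suc c)                                        ≡⟨ pBox-raiseLargest n a c ⟩
  pBox n a (suc c) + 𝟙 (suc a ≤? n) * pBox (n ∸ suc a) (suc a) c
    ≡⟨ cong₂ (λ x y → x + 𝟙 (suc a ≤? n) * y) (pBox-sym n a (suc c)) (pBox-sym (n ∸ suc a) (suc a) c) ⟩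
  pBox n (suc c) a + 𝟙 (suc a ≤? n) * pBox (n ∸ suc a) c (suc a) ≡⟨ sym (pBox-raiseLength n c a) ⟩
  pBox n (suc c) (suc a)                                        ∎

pBox-anyLength : ∀ n a → pBox n a n ≡ pBounded n a
pBox-anyLength n a = trans (∑-partsLe-cong n a (λ μ len≤n _ → 𝟙-yes (length μ ≤? n) len≤n)) (∑ₗ-1 (partsLe n a))

count-length≤ : ∀ n c → ∑[ μ ∈ partitions n ] 𝟙 (length μ ≤? c) ≡ pBounded n c
count-length≤ n c = trans (pBox-sym n n c) (pBox-anyLength n c)

count-largest≤ : ∀ n c → ∑[ μ ∈ partitions n ] 𝟙 (largest μ ≤? c) ≡ pBounded n c
count-largest≤ zero    c = refl
count-largest≤ (suc m) c = begin
  ∑[ μ ∈ partitions (suc m) ] 𝟙 (largest μ ≤? c)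
    ≡⟨ ∑-partitions-suc m (λ μ → 𝟙 (largest μ ≤? c)) ⟩
  ∑[ i < suc m ] ∑[ ν ∈ partsLe (m ∸ i) (suc i) ] 𝟙 (suc i ≤? c)
    ≡⟨ ∑-cong (suc m) (λ i _ → ∑ₗ-const (𝟙 (suc i ≤? c)) (partsLe (m ∸ i) (suc i))) ⟩
  ∑[ i < suc m ] (𝟙 (suc i ≤? c) * pBounded (m ∸ i) (suc i))
    ≡⟨ ∑-restrict (c ⊓ suc m) (suc m) _ (λ i → suc i ≤? c) (ℕ.m⊓n≤n c (suc m))
         (λ i i<c⊓n → ℕ.≤-trans i<c⊓n (ℕ.m⊓n≤m c (suc m)))
         (λ i c⊓n≤i i<n i<c → ℕ.<⇒≱ (ℕ.⊓-glb i<c i<n) c⊓n≤i) ⟩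
  ∑[ i < c ⊓ suc m ] pBounded (m ∸ i) (suc i)
    ≡⟨ ∑-cong (c ⊓ suc m) (λ i _ → sym (∑ₗ-1 (partsLe (m ∸ i) (suc i)))) ⟩
  ∑[ i < c ⊓ suc m ] ∑[ ν ∈ partsLe (m ∸ i) (suc i) ] (+ 1)
    ≡⟨ sym (∑-partsLe-suc m c (λ _ → + 1)) ⟩
  ∑[ μ ∈ partsLe (suc m) c ] (+ 1)
    ≡⟨ ∑ₗ-1 (partsLe (suc m) c) ⟩
  pBounded (suc m) c ∎

count-≟-from-≤ : ∀ {a} {A : Set a} (xs : List A) (φ ψ : A → ℕ) →
  (∀ c → ∑[ x ∈ xs ] 𝟙 (φ x ≤? c) ≡ ∑[ x ∈ xs ] 𝟙 (ψ x ≤? c)) →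
  ∀ m → ∑[ x ∈ xs ] 𝟙 (φ x ℕ.≟ m) ≡ ∑[ x ∈ xs ] 𝟙 (ψ x ℕ.≟ m)
count-≟-from-≤ xs φ ψ same zero = begin
  ∑[ x ∈ xs ] 𝟙 (φ x ℕ.≟ 0)  ≡⟨ ∑ₗ-cong xs (𝟙-≟0 ∘ φ) ⟩
  ∑[ x ∈ xs ] 𝟙 (φ x ≤? 0)   ≡⟨ same 0 ⟩
  ∑[ x ∈ xs ] 𝟙 (ψ x ≤? 0)   ≡⟨ sym (∑ₗ-cong xs (𝟙-≟0 ∘ ψ)) ⟩
  ∑[ x ∈ xs ] 𝟙 (ψ x ℕ.≟ 0)  ∎
count-≟-from-≤ xs φ ψ same (suc c) = ∙-cancelˡ (∑[ x ∈ xs ] 𝟙 (φ x ≤? c)) _ _ (begin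
  ∑[ x ∈ xs ] 𝟙 (φ x ≤? c) + ∑[ x ∈ xs ] 𝟙 (φ x ℕ.≟ suc c)  ≡⟨ splitAt φ ⟨
  ∑[ x ∈ xs ] 𝟙 (φ x ≤? suc c)                               ≡⟨ same (suc c) ⟩
  ∑[ x ∈ xs ] 𝟙 (ψ x ≤? suc c)                               ≡⟨ splitAt ψ ⟩
  ∑[ x ∈ xs ] 𝟙 (ψ x ≤? c) + ∑[ x ∈ xs ] 𝟙 (ψ x ℕ.≟ suc c)  ≡⟨ cong (_+ ∑[ x ∈ xs ] 𝟙 (ψ x ℕ.≟ suc c)) (sym (same c)) ⟩
  ∑[ x ∈ xs ] 𝟙 (φ x ≤? c) + ∑[ x ∈ xs ] 𝟙 (ψ x ℕ.≟ suc c)  ∎)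
  where
  splitAt : ∀ χ → ∑[ x ∈ xs ] 𝟙 (χ x ≤? suc c) ≡ ∑[ x ∈ xs ] 𝟙 (χ x ≤? c) + ∑[ x ∈ xs ] 𝟙 (χ x ℕ.≟ suc c)
  splitAt χ = trans (∑ₗ-cong xs (λ x → 𝟙-≤-suc (χ x) c)) (∑ₗ-distrib-+ xs (λ x → 𝟙 (χ x ≤? c)) (λ x → 𝟙 (χ x ℕ.≟ suc c)))

count-length≡count-largest : ∀ n m →
  ∑[ μ ∈ partitions n ] 𝟙 (length μ ℕ.≟ m) ≡ ∑[ μ ∈ partitions n ] 𝟙 (largest μ ℕ.≟ m)
count-length≡count-largest n = count-≟-from-≤ (partitions n) length largest
  (λ c → trans (count-length≤ n c) (sym (count-largest≤ n c)))

-- Moments as sums over partitions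

pos-∸ : ∀ {m n} → n ≤ m → + (m ∸ n) ≡ + m - + n
pos-∸ {m} {n} n≤m = sym (trans (ℤ.[+m]-[+n]≡m⊖n m n) (ℤ.⊖-≥ n≤m))

p≡∑1 : ∀ n → + p n ≡ ∑[ μ ∈ partitions n ] (+ 1)
p≡∑1 n = sym (∑ₗ-1 (partitions n))

∑-byValue : ∀ (φ : List ℕ → ℕ) (h : ℕ → ℤ) n → (∀ μ → length μ ≤ n → largest μ ≤ n → φ μ ≤ n) →
  ∑[ m < suc n ] (h m * ∑[ μ ∈ partitions n ] 𝟙 (φ μ ℕ.≟ m)) ≡ ∑[ μ ∈ partitions n ] h (φ μ)
∑-byValue φ h n φ≤n = begin
  ∑[ m < suc n ] (h m * ∑[ μ ∈ partitions n ] 𝟙 (φ μ ℕ.≟ m))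
    ≡⟨ ∑-cong (suc n) (λ m _ → *-distribˡ-∑ₗ (h m) (partitions n) (λ μ → 𝟙 (φ μ ℕ.≟ m))) ⟩
  ∑[ m < suc n ] ∑[ μ ∈ partitions n ] (h m * 𝟙 (φ μ ℕ.≟ m))
    ≡⟨ sym (∑ₗ-comm-∑ (partitions n) (suc n) (λ μ m → h m * 𝟙 (φ μ ℕ.≟ m))) ⟩
  ∑[ μ ∈ partitions n ] ∑[ m < suc n ] (h m * 𝟙 (φ μ ℕ.≟ m))
    ≡⟨ ∑-partsLe-cong n n (λ μ len≤n largest≤n → ∑-pick (suc n) h (φ μ) (s≤s (φ≤n μ len≤n largest≤n))) ⟩
  ∑[ μ ∈ partitions n ] h (φ μ) ∎

p₂-byLength : ∀ n → p₂ n ≡ ∑[ m < suc n ] ((+ m * + m) * ∑[ μ ∈ partitions n ] 𝟙 (length μ ℕ.≟ m))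
p₂-byLength n = trans (sumℤ-range 0 n (λ m → + (m ℕ.* m ℕ.* pmn m n))) (∑-cong (suc n) λ m _ → begin
  + (m ℕ.* m ℕ.* pmn m n)      ≡⟨ ℤ.pos-* (m ℕ.* m) (pmn m n) ⟩
  + (m ℕ.* m) * + pmn m n      ≡⟨ cong₂ _*_ (ℤ.pos-* m m) (length-filter (λ μ → length μ ℕ.≟ m) (partitions n)) ⟩
  (+ m * + m) * ∑[ μ ∈ partitions n ] 𝟙 (length μ ℕ.≟ m) ∎)

p₂≡∑length² : ∀ n → p₂ n ≡ ∑[ μ ∈ partitions n ] (+ length μ * + length μ)
p₂≡∑length² n = trans (p₂-byLength n) (∑-byValue length (λ m → + m * + m) n (λ μ len≤n _ → len≤n))

p₂≡∑largest² : ∀ n → p₂ n ≡ ∑[ μ ∈ partitions n ] (+ largest μ * + largest μ)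
p₂≡∑largest² n = begin
  p₂ n
    ≡⟨ p₂-byLength n ⟩
  ∑[ m < suc n ] ((+ m * + m) * ∑[ μ ∈ partitions n ] 𝟙 (length μ ℕ.≟ m))
    ≡⟨ ∑-cong (suc n) (λ m _ → cong ((+ m * + m) *_) (count-length≡count-largest n m)) ⟩
  ∑[ m < suc n ] ((+ m * + m) * ∑[ μ ∈ partitions n ] 𝟙 (largest μ ℕ.≟ m))
    ≡⟨ ∑-byValue largest (λ m → + m * + m) n (λ μ _ largest≤n → largest≤n) ⟩
  ∑[ μ ∈ partitions n ] (+ largest μ * + largest μ) ∎

N₂≡∑rank² : ∀ n → N₂ n ≡ ∑[ μ ∈ partitions n ] (rank μ * rank μ)
N₂≡∑rank² n = begin
  N₂ n
    ≡⟨ sumℤ-range 0 (n ℕ.+ n) (λ j → square j * + Nrank (level j) n) ⟩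
  ∑[ j < suc (n ℕ.+ n) ] (square j * + Nrank (level j) n)
    ≡⟨ ∑-cong (suc (n ℕ.+ n)) (λ j _ → cong (square j *_) (length-filter (λ μ → rank μ ℤ.≟ level j) (partitions n))) ⟩
  ∑[ j < suc (n ℕ.+ n) ] (square j * ∑[ μ ∈ partitions n ] 𝟙 (rank μ ℤ.≟ level j))
    ≡⟨ ∑-cong (suc (n ℕ.+ n)) (λ j _ → *-distribˡ-∑ₗ (square j) (partitions n) (λ μ → 𝟙 (rank μ ℤ.≟ level j))) ⟩
  ∑[ j < suc (n ℕ.+ n) ] ∑[ μ ∈ partitions n ] (square j * 𝟙 (rank μ ℤ.≟ level j))
    ≡⟨ sym (∑ₗ-comm-∑ (partitions n) (suc (n ℕ.+ n)) (λ μ j → square j * 𝟙 (rank μ ℤ.≟ level j))) ⟩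
  ∑[ μ ∈ partitions n ] ∑[ j < suc (n ℕ.+ n) ] (square j * 𝟙 (rank μ ℤ.≟ level j))
    ≡⟨ ∑-partsLe-cong n n pickRank ⟩
  ∑[ μ ∈ partitions n ] (rank μ * rank μ) ∎
  where
  level : ℕ → ℤ
  level j = + j - + n
  square : ℕ → ℤ
  square j = level j * level j
  shifted : List ℕ → ℕ
  shifted μ = largest μ ℕ.+ (n ∸ length μ)
  level-shifted : ∀ μ → length μ ≤ n → level (shifted μ) ≡ rank μ
  level-shifted μ len≤n = begin
    + (largest μ ℕ.+ (n ∸ length μ)) - + n    ≡⟨ cong (λ t → t - + n) (trans (ℤ.pos-+ (largest μ) (n ∸ length μ)) (cong (_+_ (+ largest μ)) (pos-∸ len≤n))) ⟩
    (+ largest μ + (+ n - + length μ)) - + n  ≡⟨ cancel (+ largest μ) (+ n) (+ length μ) ⟩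
    + largest μ - + length μ                  ∎
    where
    cancel : ∀ a b c → (a + (b - c)) - b ≡ a - c
    cancel = solve-∀
  pickRank : ∀ μ → length μ ≤ n → largest μ ≤ n →
    ∑[ j < suc (n ℕ.+ n) ] (square j * 𝟙 (rank μ ℤ.≟ level j)) ≡ rank μ * rank μ
  pickRank μ len≤n largest≤n = begin
    ∑[ j < suc (n ℕ.+ n) ] (square j * 𝟙 (rank μ ℤ.≟ level j))
      ≡⟨ ∑-cong (suc (n ℕ.+ n)) (λ j _ → cong (square j *_) (𝟙-⇔ (rank μ ℤ.≟ level j) (shifted μ ℕ.≟ j)
           (λ eq → ℤ.+-injective (∙-cancelʳ (- + n) (+ shifted μ) (+ j) (trans (level-shifted μ len≤n) eq)))
           (λ eq → trans (sym (level-shifted μ len≤n)) (cong level eq)))) ⟩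
    ∑[ j < suc (n ℕ.+ n) ] (square j * 𝟙 (shifted μ ℕ.≟ j))
      ≡⟨ ∑-pick (suc (n ℕ.+ n)) square (shifted μ) (s≤s (ℕ.+-mono-≤ largest≤n (ℕ.m∸n≤m n (length μ)))) ⟩
    square (shifted μ)
      ≡⟨ cong₂ _*_ (level-shifted μ len≤n) (level-shifted μ len≤n) ⟩
    rank μ * rank μ ∎

-- Counting parts of a given size

dv : ℕ → ℕ → ℤ
dv d x = 𝟙 (d ∣? x)

dv-vanish : ∀ d x → 0 < x → x < d → dv d x ≡ + 0
dv-vanish d x 0<x x<d = 𝟙-no (d ∣? x) (>⇒∤ {{ℕ.>-nonZero 0<x}} x<d)

dv-+ : ∀ d x → dv d (x ℕ.+ d) ≡ dv d x
dv-+ d x = 𝟙-⇔ (d ∣? x ℕ.+ d) (d ∣? x)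
  (λ d∣x+d → ∣m+n∣m⇒∣n (subst (d ∣_) (ℕ.+-comm x d) d∣x+d) ∣-refl)
  (λ d∣x → ∣m∣n⇒∣m+n d∣x ∣-refl)

convDiv : ℕ → ℕ → (ℕ → ℤ) → ℤ
convDiv d r h = ∑[ s < r ] (dv d (r ∸ s) * h s)

convDiv-small : ∀ d r (h : ℕ → ℤ) → r < d → convDiv d r h ≡ + 0
convDiv-small d r h r<d = ∑-zero r λ s s<r →
  trans (cong (_* h s) (dv-vanish d (r ∸ s) (ℕ.m<n⇒0<n∸m s<r) (ℕ.≤-trans (s≤s (ℕ.m∸n≤m r s)) r<d))) (ℤ.*-zeroˡ (h s))

convDiv-unfold : ∀ d r (h : ℕ → ℤ) → 0 < d → d ≤ r → convDiv d r h ≡ h (r ∸ d) + convDiv d (r ∸ d) h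
convDiv-unfold d r h 0<d d≤r = subst (λ r′ → convDiv d r′ h ≡ h (r ∸ d) + convDiv d (r ∸ d) h)
  (ℕ.m∸n+n≡m d≤r) (unfold (r ∸ d) d h 0<d)
  where
  unfold : ∀ q d (h : ℕ → ℤ) → 0 < d → convDiv d (q ℕ.+ d) h ≡ h q + convDiv d q h
  unfold q d@(suc d′) h _ = begin
    convDiv d (q ℕ.+ d) h
      ≡⟨ ∑-split q d _ ⟩
    ∑[ s < q ] (dv d (q ℕ.+ d ∸ s) * h s) + ∑[ t < d ] (dv d (q ℕ.+ d ∸ (q ℕ.+ t)) * h (q ℕ.+ t))
      ≡⟨ cong₂ _+_ (∑-cong q (λ s s<q → cong (_* h s) (trans (cong (dv d) (ℕ.+-∸-comm d (ℕ.<⇒≤ s<q))) (dv-+ d (q ∸ s)))))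
                   (∑-cong d (λ t _ → cong (λ z → dv d z * h (q ℕ.+ t)) (ℕ.[m+n]∸[m+o]≡n∸o q d t))) ⟩
    convDiv d q h + ∑[ t < d ] (dv d (d ∸ t) * h (q ℕ.+ t))
      ≡⟨ cong (_+_ (convDiv d q h)) lastBlock ⟩
    convDiv d q h + h q
      ≡⟨ ℤ.+-comm (convDiv d q h) (h q) ⟩
    h q + convDiv d q h ∎
    where
    lastBlock : ∑[ t < d ] (dv d (d ∸ t) * h (q ℕ.+ t)) ≡ h q
    lastBlock = begin
      dv d d * h (q ℕ.+ 0) + ∑[ t < d′ ] (dv d (d′ ∸ t) * h (q ℕ.+ suc t))
        ≡⟨ cong₂ _+_ (cong₂ _*_ (𝟙-yes (d ∣? d) ∣-refl) (cong h (ℕ.+-identityʳ q)))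
                     (convDiv-small d d′ (λ t → h (q ℕ.+ suc t)) ℕ.≤-refl) ⟩
      + 1 * h q + + 0
        ≡⟨ trans (ℤ.+-identityʳ _) (ℤ.*-identityˡ _) ⟩
      h q ∎

convDiv-shift : ∀ d r c (h : ℕ → ℤ) →
  convDiv d r (λ s → 𝟙 (c ≤? s) * h (s ∸ c)) ≡ 𝟙 (c ≤? r) * convDiv d (r ∸ c) h
convDiv-shift d r c h = shift (c ≤? r)
  where
  shifted : ℕ → ℤ
  shifted s = 𝟙 (c ≤? s) * h (s ∸ c)
  shift : (c≤?r : Dec (c ≤ r)) → convDiv d r shifted ≡ 𝟙 c≤?r * convDiv d (r ∸ c) h
  shift (yes c≤r) = begin
    convDiv d r shifted
      ≡⟨ ∑-drop c r _ c≤r (λ s s<c → trans (cong (λ z → dv d (r ∸ s) * (z * h (s ∸ c))) (𝟙-no (c ≤? s) (ℕ.<⇒≱ s<c)))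
                                      (trans (cong (dv d (r ∸ s) *_) (ℤ.*-zeroˡ (h (s ∸ c)))) (ℤ.*-zeroʳ (dv d (r ∸ s))))) ⟩
    ∑[ t < r ∸ c ] (dv d (r ∸ (c ℕ.+ t)) * shifted (c ℕ.+ t))
      ≡⟨ ∑-cong (r ∸ c) (λ t _ → cong₂ (λ x y → dv d x * y) (sym (ℕ.∸-+-assoc r c t))
           (trans (cong₂ _*_ (𝟙-yes (c ≤? c ℕ.+ t) (ℕ.m≤m+n c t)) (cong h (ℕ.m+n∸m≡n c t))) (ℤ.*-identityˡ _))) ⟩
    convDiv d (r ∸ c) h
      ≡⟨ sym (ℤ.*-identityˡ _) ⟩
    + 1 * convDiv d (r ∸ c) h ∎
  shift (no c≰r) = trans (∑-zero r λ s s<r →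
      trans (cong (λ z → dv d (r ∸ s) * (z * h (s ∸ c))) (𝟙-no (c ≤? s) (λ c≤s → c≰r (ℕ.≤-trans c≤s (ℕ.<⇒≤ s<r)))))
            (trans (cong (dv d (r ∸ s) *_) (ℤ.*-zeroˡ (h (s ∸ c)))) (ℤ.*-zeroʳ (dv d (r ∸ s)))))
    (sym (ℤ.*-zeroˡ (convDiv d (r ∸ c) h)))

pBounded-raise : ∀ s b → pBounded s (suc b) ≡ pBounded s b + 𝟙 (suc b ≤? s) * pBounded (s ∸ suc b) (suc b)
pBounded-raise s b = begin
  pBounded s (suc b)
    ≡⟨ sym (∑ₗ-1 (partsLe s (suc b))) ⟩
  ∑[ μ ∈ partsLe s (suc b) ] (+ 1)
    ≡⟨ ∑-partsLe-raise s b (λ _ → + 1) ⟩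
  ∑[ μ ∈ partsLe s b ] (+ 1) + 𝟙 (suc b ≤? s) * ∑[ ν ∈ partsLe (s ∸ suc b) (suc b) ] (+ 1)
    ≡⟨ cong₂ (λ x y → x + 𝟙 (suc b ≤? s) * y) (∑ₗ-1 (partsLe s b)) (∑ₗ-1 (partsLe (s ∸ suc b) (suc b))) ⟩
  pBounded s b + 𝟙 (suc b ≤? s) * pBounded (s ∸ suc b) (suc b) ∎

-- For d ≤ b, the total number of parts equal to d over all partitions of r
-- with parts ≤ b: such a partition with j ≥ 1 parts d is one of r − j d
-- with parts ≤ b, plus j copies of d.
occurrences : ℕ → ℕ → ℕ → ℤ
occurrences d r b = convDiv d r (λ s → pBounded s b)

occurrences-raise : ∀ d r b →
  occurrences d r (suc b) ≡ occurrences d r b + 𝟙 (suc b ≤? r) * occurrences d (r ∸ suc b) (suc b)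
occurrences-raise d r b = begin
  occurrences d r (suc b)
    ≡⟨ ∑-cong r (λ s _ → trans (cong (dv d (r ∸ s) *_) (pBounded-raise s b)) (ℤ.*-distribˡ-+ (dv d (r ∸ s)) _ _)) ⟩
  ∑[ s < r ] (dv d (r ∸ s) * pBounded s b + dv d (r ∸ s) * (𝟙 (suc b ≤? s) * pBounded (s ∸ suc b) (suc b)))
    ≡⟨ ∑-distrib-+ r _ _ ⟩
  occurrences d r b + convDiv d r (λ s → 𝟙 (suc b ≤? s) * pBounded (s ∸ suc b) (suc b))
    ≡⟨ cong (_+_ (occurrences d r b)) (convDiv-shift d r (suc b) (λ s → pBounded s (suc b))) ⟩
  occurrences d r b + 𝟙 (suc b ≤? r) * occurrences d (r ∸ suc b) (suc b) ∎

-- Both sides count the partitions of r with parts ≤ b + 1 containing the part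
-- b + 1, the left one grouped by the multiplicity of that part.
occurrences-top : ∀ b r → occurrences (suc b) r b ≡ 𝟙 (suc b ≤? r) * pBounded (r ∸ suc b) (suc b)
occurrences-top b = <-rec Claim claim
  where
  Claim : ℕ → Set
  Claim r = occurrences (suc b) r b ≡ 𝟙 (suc b ≤? r) * pBounded (r ∸ suc b) (suc b)
  byCases : ∀ r → (∀ {k} → k < r → Claim k) → (b<?r : Dec (suc b ≤ r)) →
    occurrences (suc b) r b ≡ 𝟙 b<?r * pBounded (r ∸ suc b) (suc b)
  byCases r rec (no b≮r) = trans (convDiv-small (suc b) r _ (ℕ.≰⇒> b≮r)) (sym (ℤ.*-zeroˡ (pBounded (r ∸ suc b) (suc b))))
  byCases r rec (yes b<r) = begin
    occurrences (suc b) r b                                    ≡⟨ convDiv-unfold (suc b) r _ z<s b<r ⟩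
    pBounded r′ b + occurrences (suc b) r′ b                   ≡⟨ cong (_+_ (pBounded r′ b)) (rec (ℕ.∸-monoʳ-< z<s b<r)) ⟩
    pBounded r′ b + 𝟙 (suc b ≤? r′) * pBounded (r′ ∸ suc b) (suc b) ≡⟨ sym (pBounded-raise r′ b) ⟩
    pBounded r′ (suc b)                                        ≡⟨ sym (ℤ.*-identityˡ _) ⟩
    + 1 * pBounded r′ (suc b)                                  ∎
    where
    r′ = r ∸ suc b
  claim : ∀ r → (∀ {k} → k < r → Claim k) → Claim r
  claim r rec = byCases r rec (suc b ≤? r)

lengthWeight : ℕ → ℕ → ℕ → ℤ
lengthWeight c r b = ∑[ ν ∈ partsLe r b ] (+ c * + length ν - + r)

occurrenceWeight : ℕ → ℕ → ℕ → ℤ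
occurrenceWeight c r b = ∑[ e < b ] ((+ c - + suc e) * occurrences (suc e) r b)

lengthWeight-raise : ∀ c r b → lengthWeight c r (suc b) ≡
  lengthWeight c r b + 𝟙 (suc b ≤? r) * (lengthWeight c (r ∸ suc b) (suc b) + (+ c - + suc b) * pBounded (r ∸ suc b) (suc b))
lengthWeight-raise c r b = trans (∑-partsLe-raise r b (λ ν → + c * + length ν - + r))
  (cong (_+_ (lengthWeight c r b)) (𝟙-*-cong (suc b ≤? r) newPart))
  where
  r′ = r ∸ suc b
  regroup : ∀ k l s t → k * (+ 1 + l) - (s + t) ≡ (k * l - s) + (k - t) * + 1
  regroup = solve-∀
  newPart : suc b ≤ r → ∑[ ν ∈ partsLe r′ (suc b) ] (+ c * + suc (length ν) - + r) ≡
                          lengthWeight c r′ (suc b) + (+ c - + suc b) * pBounded r′ (suc b)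
  newPart b<r = begin
    ∑[ ν ∈ partsLe r′ (suc b) ] (+ c * + suc (length ν) - + r)
      ≡⟨ ∑ₗ-cong (partsLe r′ (suc b)) (λ ν → trans (cong (λ z → + c * + suc (length ν) - z) r≡r′+b) (regroup (+ c) (+ length ν) (+ r′) (+ suc b))) ⟩
    ∑[ ν ∈ partsLe r′ (suc b) ] ((+ c * + length ν - + r′) + (+ c - + suc b) * + 1)
      ≡⟨ ∑ₗ-distrib-+ (partsLe r′ (suc b)) (λ ν → + c * + length ν - + r′) (λ _ → (+ c - + suc b) * + 1) ⟩
    lengthWeight c r′ (suc b) + ∑[ ν ∈ partsLe r′ (suc b) ] ((+ c - + suc b) * + 1)
      ≡⟨ cong (_+_ (lengthWeight c r′ (suc b))) (trans (∑ₗ-const ((+ c - + suc b) * + 1) (partsLe r′ (suc b))) (cong (_* pBounded r′ (suc b)) (ℤ.*-identityʳ (+ c - + suc b)))) ⟩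
    lengthWeight c r′ (suc b) + (+ c - + suc b) * pBounded r′ (suc b) ∎
    where
    r≡r′+b : + r ≡ + r′ + + suc b
    r≡r′+b = trans (cong +_ (sym (ℕ.m∸n+n≡m b<r))) (ℤ.pos-+ r′ (suc b))

occurrenceWeight-raise : ∀ c r b → occurrenceWeight c r (suc b) ≡
  occurrenceWeight c r b + ((+ c - + suc b) * occurrences (suc b) r b + 𝟙 (suc b ≤? r) * occurrenceWeight c (r ∸ suc b) (suc b))
occurrenceWeight-raise c r b = begin
  occurrenceWeight c r (suc b)
    ≡⟨ ∑-last b _ ⟩
  ∑[ e < b ] (weight e * occurrences (suc e) r (suc b)) + weight b * occurrences (suc b) r (suc b)
    ≡⟨ cong₂ _+_ (∑-cong b (λ e _ → trans (cong (weight e *_) (occurrences-raise (suc e) r b)) (expand (weight e) _ i _)))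
                 (cong (weight b *_) (occurrences-raise (suc b) r b)) ⟩
  ∑[ e < b ] (weight e * occurrences (suc e) r b + i * (weight e * occurrences (suc e) r′ (suc b)))
    + weight b * (occurrences (suc b) r b + i * occurrences (suc b) r′ (suc b))
    ≡⟨ cong (_+ weight b * (occurrences (suc b) r b + i * occurrences (suc b) r′ (suc b)))
         (trans (∑-distrib-+ b _ _) (cong (_+_ (occurrenceWeight c r b)) (sym (*-distribˡ-∑ b i _)))) ⟩
  (occurrenceWeight c r b + i * ∑[ e < b ] (weight e * occurrences (suc e) r′ (suc b)))
    + weight b * (occurrences (suc b) r b + i * occurrences (suc b) r′ (suc b))
    ≡⟨ regroup (occurrenceWeight c r b) _ i (weight b) (occurrences (suc b) r b) (occurrences (suc b) r′ (suc b)) ⟩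
  occurrenceWeight c r b + (weight b * occurrences (suc b) r b
    + i * (∑[ e < b ] (weight e * occurrences (suc e) r′ (suc b)) + weight b * occurrences (suc b) r′ (suc b)))
    ≡⟨ cong (λ z → occurrenceWeight c r b + (weight b * occurrences (suc b) r b + i * z)) (sym (∑-last b _)) ⟩
  occurrenceWeight c r b + (weight b * occurrences (suc b) r b + i * occurrenceWeight c r′ (suc b)) ∎
  where
  r′ = r ∸ suc b
  i = 𝟙 (suc b ≤? r)
  weight : ℕ → ℤ
  weight e = + c - + suc e
  expand : ∀ w o j o′ → w * (o + j * o′) ≡ w * o + j * (w * o′)
  expand = solve-∀
  regroup : ∀ y s i w o o′ → (y + i * s) + w * (o + i * o′) ≡ y + (w * o + i * (s + w * o′))
  regroup = solve-∀

-- Both sides are Σ_ν Σ_{parts x of ν} (c − x), summed by partition on the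
-- left and by part size on the right.
lengthWeight≡occurrenceWeight : ∀ c r b → lengthWeight c r b ≡ occurrenceWeight c r b
lengthWeight≡occurrenceWeight c = <-rec Claim claim
  where
  Claim : ℕ → Set
  Claim r = ∀ b → lengthWeight c r b ≡ occurrenceWeight c r b
  noParts : ∀ r → lengthWeight c r 0 ≡ + 0
  noParts zero    = cong (λ z → z - + 0 + + 0) (ℤ.*-zeroʳ (+ c))
  noParts (suc r) = refl
  claim : ∀ r → (∀ {k} → k < r → Claim k) → Claim r
  claim r rec zero    = noParts r
  claim r rec (suc b) = begin
    lengthWeight c r (suc b)
      ≡⟨ lengthWeight-raise c r b ⟩
    lengthWeight c r b + i * (lengthWeight c r′ (suc b) + k * pBounded r′ (suc b))
      ≡⟨ cong₂ _+_ (claim r rec b) (𝟙-*-cong (suc b ≤? r) λ b<r → cong (_+ k * pBounded r′ (suc b)) (rec (ℕ.∸-monoʳ-< z<s b<r) (suc b))) ⟩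
    occurrenceWeight c r b + i * (occurrenceWeight c r′ (suc b) + k * pBounded r′ (suc b))
      ≡⟨ cong (_+_ (occurrenceWeight c r b)) (regroup i (occurrenceWeight c r′ (suc b)) k (pBounded r′ (suc b))) ⟩
    occurrenceWeight c r b + (k * (i * pBounded r′ (suc b)) + i * occurrenceWeight c r′ (suc b))
      ≡⟨ cong (λ z → occurrenceWeight c r b + (k * z + i * occurrenceWeight c r′ (suc b))) (sym (occurrences-top b r)) ⟩
    occurrenceWeight c r b + (k * occurrences (suc b) r b + i * occurrenceWeight c r′ (suc b))
      ≡⟨ sym (occurrenceWeight-raise c r b) ⟩
    occurrenceWeight c r (suc b) ∎
    where
    r′ = r ∸ suc b
    i = 𝟙 (suc b ≤? r)
    k = + c - + suc b
    regroup : ∀ i y k p → i * (y + k * p) ≡ k * (i * p) + i * y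
    regroup = solve-∀

-- The sum S as a sum over partitions

-- Σ over λ ⊢ m + 1 with largest part i + 1 and over the further parts e + 1 of λ
-- of i − e.
deficitSum : ℕ → ℤ
deficitSum m = ∑[ i < suc m ] ∑[ e < suc m ] (occurrences (suc e) (m ∸ i) (suc i) * + (i ∸ e))

∑-largest*length≡deficitSum : ∀ m → ∑[ μ ∈ partitions (suc m) ] (+ largest μ * + length μ - + suc m) ≡ deficitSum m
∑-largest*length≡deficitSum m = begin
  ∑[ μ ∈ partitions n ] (+ largest μ * + length μ - + n)
    ≡⟨ ∑-partitions-suc m (λ μ → + largest μ * + length μ - + n) ⟩
  ∑[ i < n ] ∑[ ν ∈ partsLe (m ∸ i) (suc i) ] (+ suc i * + suc (length ν) - + n)
    ≡⟨ ∑-cong n (λ i i<n → trans (∑ₗ-cong (partsLe (m ∸ i) (suc i)) (dropLargest i i<n)) (lengthWeight≡occurrenceWeight (suc i) (m ∸ i) (suc i))) ⟩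
  ∑[ i < n ] occurrenceWeight (suc i) (m ∸ i) (suc i)
    ≡⟨ ∑-cong n extendParts ⟩
  deficitSum m ∎
  where
  n = suc m
  dropLargest : ∀ i → i < n → ∀ ν → + suc i * + suc (length ν) - + n ≡ + suc i * + length ν - + (m ∸ i)
  dropLargest i i<n ν = begin
    + suc i * + suc (length ν) - + n                ≡⟨ cong (λ z → + suc i * + suc (length ν) - z) (trans (cong +_ (sym (ℕ.m∸n+n≡m i<n))) (ℤ.pos-+ (m ∸ i) (suc i))) ⟩
    + suc i * (+ 1 + + length ν) - (+ (m ∸ i) + + suc i) ≡⟨ cancel (+ suc i) (+ length ν) (+ (m ∸ i)) ⟩
    + suc i * + length ν - + (m ∸ i)                ∎
    where
    cancel : ∀ k l r → k * (+ 1 + l) - (r + k) ≡ k * l - r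
    cancel = solve-∀
  extendParts : ∀ i → i < n → occurrenceWeight (suc i) (m ∸ i) (suc i) ≡ ∑[ e < n ] (occurrences (suc e) (m ∸ i) (suc i) * + (i ∸ e))
  extendParts i i<n = begin
    ∑[ e < suc i ] ((+ suc i - + suc e) * occ e)  ≡⟨ ∑-cong (suc i) (λ e e<i+1 → trans (cong (_* occ e) (sym (pos-∸ e<i+1))) (ℤ.*-comm (+ (i ∸ e)) (occ e))) ⟩
    ∑[ e < suc i ] (occ e * + (i ∸ e))            ≡⟨ ∑-truncate (suc i) n _ i<n (λ e i<e _ → trans (cong (λ z → occ e * + z) (ℕ.m≤n⇒m∸n≡0 (ℕ.<⇒≤ i<e))) (ℤ.*-zeroʳ (occ e))) ⟨
    ∑[ e < n ] (occ e * + (i ∸ e))                ∎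
    where
    occ : ℕ → ℤ
    occ e = occurrences (suc e) (m ∸ i) (suc i)

f-byLargest : ∀ a c → f (suc a) (suc c) ≡ ∑[ i < suc a ] ((+ 1 - 𝟙 (suc i ≤? suc c)) * pBounded (a ∸ i) (suc i))
f-byLargest a c = begin
  + p (suc a) - + pLe (suc c) (suc a)
    ≡⟨ cong₂ _-_ (p≡∑1 (suc a)) (length-filter (λ μ → largest μ ≤? suc c) (partitions (suc a))) ⟩
  ∑[ μ ∈ partitions (suc a) ] (+ 1) - ∑[ μ ∈ partitions (suc a) ] 𝟙 (largest μ ≤? suc c)
    ≡⟨ sym (∑ₗ-distrib-- (partitions (suc a)) (λ _ → + 1) (λ μ → 𝟙 (largest μ ≤? suc c))) ⟩
  ∑[ μ ∈ partitions (suc a) ] (+ 1 - 𝟙 (largest μ ≤? suc c))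
    ≡⟨ ∑-partitions-suc a (λ μ → + 1 - 𝟙 (largest μ ≤? suc c)) ⟩
  ∑[ i < suc a ] ∑[ ν ∈ partsLe (a ∸ i) (suc i) ] (+ 1 - 𝟙 (suc i ≤? suc c))
    ≡⟨ ∑-cong (suc a) (λ i _ → ∑ₗ-const (+ 1 - 𝟙 (suc i ≤? suc c)) (partsLe (a ∸ i) (suc i))) ⟩
  ∑[ i < suc a ] ((+ 1 - 𝟙 (suc i ≤? suc c)) * pBounded (a ∸ i) (suc i)) ∎

-- Unlike dv, this follows the convention of g that 0 has no divisors.
dv⁺ : ℕ → ℕ → ℤ
dv⁺ d zero    = + 0
dv⁺ d (suc r) = dv d (suc r)

g-byDivisor : ∀ r c → g (+ r) (suc c) ≡ ∑[ e < suc c ] dv⁺ (suc e) r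
g-byDivisor zero    c = sym (∑-zero (suc c) (λ _ _ → refl))
g-byDivisor (suc r) c = trans (length-filter (λ d → d ∣? suc r) (range 1 (suc c))) (sumℤ-range 1 (suc c) (λ d → dv d (suc r)))

∑-extend : ∀ a n (h : ℕ → ℤ) → a < n → ∑ (suc a) h ≡ ∑[ i < n ] (𝟙 (i ≤? a) * h i)
∑-extend a n h a<n = sym (∑-restrict (suc a) n h (λ i → i ≤? a) a<n (λ i → ℕ.≤-pred) (λ i a<i _ → ℕ.<⇒≱ a<i))

count-≤ : ∀ i e → ∑[ c < i ] 𝟙 (e ≤? c) ≡ + (i ∸ e)
count-≤ i e with e ≤? i
... | yes e≤i = begin
  ∑[ c < i ] 𝟙 (e ≤? c)                  ≡⟨ ∑-drop e i _ e≤i (λ c c<e → 𝟙-no (e ≤? c) (ℕ.<⇒≱ c<e)) ⟩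
  ∑[ t < i ∸ e ] 𝟙 (e ≤? e ℕ.+ t)        ≡⟨ ∑-cong (i ∸ e) (λ t _ → 𝟙-yes (e ≤? e ℕ.+ t) (ℕ.m≤m+n e t)) ⟩
  ∑[ t < i ∸ e ] (+ 1)                   ≡⟨ ∑-const-1 (i ∸ e) ⟩
  + (i ∸ e)                              ∎
... | no e≰i = trans (∑-zero i (λ c c<i → 𝟙-no (e ≤? c) (λ e≤c → e≰i (ℕ.≤-trans e≤c (ℕ.<⇒≤ c<i)))))
                     (cong +_ (sym (ℕ.m≤n⇒m∸n≡0 (ℕ.<⇒≤ (ℕ.≰⇒> e≰i)))))

S-unfold : ∀ m → let n = suc m in S n ≡ ∑[ a < n ] ∑[ c < n ] (f (suc a) (suc c) * g (+ n - + suc a) (suc c))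
S-unfold m = trans (sumℤ-range 1 n (λ k → sumℤ (range 1 n) (λ N → f k N * g (+ n - + k) N)))
  (∑-cong n (λ a _ → sumℤ-range 1 n (λ N → f (suc a) N * g (+ n - + suc a) N)))
  where
  n = suc m

S≡deficitSum : ∀ m → S (suc m) ≡ deficitSum m
S≡deficitSum m = begin
  S n
    ≡⟨ S-unfold m ⟩
  ∑[ a < n ] ∑[ c < n ] (f (suc a) (suc c) * g (+ n - + suc a) (suc c))
    ≡⟨ ∑-cong n (λ a a<n → ∑-cong n (λ c c<n → expand a c a<n c<n)) ⟩
  ∑[ a < n ] ∑[ c < n ] ∑[ i < n ] ∑[ e < n ] (largestPart a i e * window c i e)
    ≡⟨ ∑-comm² n n (λ a c i e → largestPart a i e * window c i e) ⟩
  ∑[ i < n ] ∑[ e < n ] ∑[ a < n ] ∑[ c < n ] (largestPart a i e * window c i e)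
    ≡⟨ ∑-cong n (λ i i<n → ∑-cong n (λ e _ → begin
         ∑[ a < n ] ∑[ c < n ] (largestPart a i e * window c i e)
           ≡⟨ sym (∑-*-∑ n (λ a → largestPart a i e) (λ c → window c i e)) ⟩
         ∑[ a < n ] largestPart a i e * ∑[ c < n ] window c i e
           ≡⟨ cong₂ _*_ (∑-largestPart i e i<n) (∑-window i e i<n) ⟩
         occurrences (suc e) (m ∸ i) (suc i) * + (i ∸ e) ∎)) ⟩
  deficitSum m ∎
  where
  n = suc m
  largestPart : ℕ → ℕ → ℕ → ℤ
  largestPart a i e = 𝟙 (i ≤? a) * (pBounded (a ∸ i) (suc i) * dv⁺ (suc e) (m ∸ a))
  window : ℕ → ℕ → ℕ → ℤ
  window c i e = 𝟙 (e ≤? c) * (+ 1 - 𝟙 (suc i ≤? suc c))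

  expand : ∀ a c → a < n → c < n → f (suc a) (suc c) * g (+ n - + suc a) (suc c) ≡
    ∑[ i < n ] ∑[ e < n ] (largestPart a i e * window c i e)
  expand a c a<n c<n = begin
    f (suc a) (suc c) * g (+ n - + suc a) (suc c)
      ≡⟨ cong₂ _*_ (trans (f-byLargest a c) (∑-extend a n fTerm a<n))
                   (trans (cong (λ z → g z (suc c)) (sym (pos-∸ a<n))) (trans (g-byDivisor (m ∸ a) c) (∑-extend c n gTerm c<n))) ⟩
    ∑[ i < n ] (𝟙 (i ≤? a) * fTerm i) * ∑[ e < n ] (𝟙 (e ≤? c) * gTerm e)
      ≡⟨ ∑-*-∑ n (λ i → 𝟙 (i ≤? a) * fTerm i) (λ e → 𝟙 (e ≤? c) * gTerm e) ⟩
    ∑[ i < n ] ∑[ e < n ] ((𝟙 (i ≤? a) * fTerm i) * (𝟙 (e ≤? c) * gTerm e))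
      ≡⟨ ∑-cong n (λ i _ → ∑-cong n (λ e _ → regroup (𝟙 (i ≤? a)) (+ 1 - 𝟙 (suc i ≤? suc c)) (pBounded (a ∸ i) (suc i)) (𝟙 (e ≤? c)) (gTerm e))) ⟩
    ∑[ i < n ] ∑[ e < n ] (largestPart a i e * window c i e) ∎
    where
    fTerm gTerm : ℕ → ℤ
    fTerm i = (+ 1 - 𝟙 (suc i ≤? suc c)) * pBounded (a ∸ i) (suc i)
    gTerm e = dv⁺ (suc e) (m ∸ a)
    regroup : ∀ x k q y h → (x * (k * q)) * (y * h) ≡ (x * (q * h)) * (y * k)
    regroup = solve-∀

  ∑-window : ∀ i e → i < n → ∑[ c < n ] window c i e ≡ + (i ∸ e)
  ∑-window i e i<n = begin
    ∑[ c < n ] window c i e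
      ≡⟨ ∑-truncate i n (λ c → window c i e) (ℕ.<⇒≤ i<n) (λ c i≤c _ → trans (cong (λ z → 𝟙 (e ≤? c) * (+ 1 - z)) (𝟙-yes (suc i ≤? suc c) (s≤s i≤c))) (ℤ.*-zeroʳ (𝟙 (e ≤? c)))) ⟩
    ∑[ c < i ] window c i e
      ≡⟨ ∑-cong i (λ c c<i → trans (cong (λ z → 𝟙 (e ≤? c) * (+ 1 - z)) (𝟙-no (suc i ≤? suc c) (λ i≤c → ℕ.<⇒≱ c<i (ℕ.≤-pred i≤c)))) (ℤ.*-identityʳ (𝟙 (e ≤? c)))) ⟩
    ∑[ c < i ] 𝟙 (e ≤? c)
      ≡⟨ count-≤ i e ⟩
    + (i ∸ e) ∎

  ∑-largestPart : ∀ i e → i < n → ∑[ a < n ] largestPart a i e ≡ occurrences (suc e) (m ∸ i) (suc i)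
  ∑-largestPart i e i<n = begin
    ∑[ a < n ] largestPart a i e
      ≡⟨ ∑-drop i n (λ a → largestPart a i e) (ℕ.<⇒≤ i<n) (λ a a<i → trans (cong (_* term a) (𝟙-no (i ≤? a) (ℕ.<⇒≱ a<i))) (ℤ.*-zeroˡ (term a))) ⟩
    ∑[ t < n ∸ i ] largestPart (i ℕ.+ t) i e
      ≡⟨ ∑-cong (n ∸ i) (λ t _ → trans (cong₂ _*_ (𝟙-yes (i ≤? i ℕ.+ t) (ℕ.m≤m+n i t))
                                                  (cong₂ (λ x y → pBounded x (suc i) * dv⁺ (suc e) y) (ℕ.m+n∸m≡n i t) (sym (ℕ.∸-+-assoc m i t))))
                                        (ℤ.*-identityˡ (pBounded t (suc i) * dv⁺ (suc e) (m ∸ i ∸ t)))) ⟩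
    ∑[ t < n ∸ i ] (pBounded t (suc i) * dv⁺ (suc e) (m ∸ i ∸ t))
      ≡⟨ cong (λ k → ∑[ t < k ] (pBounded t (suc i) * dv⁺ (suc e) (m ∸ i ∸ t))) (ℕ.+-∸-assoc 1 (ℕ.≤-pred i<n)) ⟩
    ∑[ t < suc (m ∸ i) ] (pBounded t (suc i) * dv⁺ (suc e) (m ∸ i ∸ t))
      ≡⟨ ∑-last (m ∸ i) (λ t → pBounded t (suc i) * dv⁺ (suc e) (m ∸ i ∸ t)) ⟩
    ∑[ t < m ∸ i ] (pBounded t (suc i) * dv⁺ (suc e) (m ∸ i ∸ t)) + pBounded (m ∸ i) (suc i) * dv⁺ (suc e) (m ∸ i ∸ (m ∸ i))
      ≡⟨ cong₂ _+_ (∑-cong (m ∸ i) (λ t t<m∸i → trans (cong (pBounded t (suc i) *_) (positive (ℕ.m<n⇒0<n∸m t<m∸i))) (ℤ.*-comm (pBounded t (suc i)) (dv (suc e) (m ∸ i ∸ t)))))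
                   (trans (cong (λ z → pBounded (m ∸ i) (suc i) * dv⁺ (suc e) z) (ℕ.n∸n≡0 (m ∸ i))) (ℤ.*-zeroʳ (pBounded (m ∸ i) (suc i)))) ⟩
    occurrences (suc e) (m ∸ i) (suc i) + + 0
      ≡⟨ ℤ.+-identityʳ _ ⟩
    occurrences (suc e) (m ∸ i) (suc i) ∎
    where
    term : ℕ → ℤ
    term a = pBounded (a ∸ i) (suc i) * dv⁺ (suc e) (m ∸ a)
    positive : ∀ {x} → 0 < x → dv⁺ (suc e) x ≡ dv (suc e) x
    positive {suc x} _ = refl

-- The q-series side

-- The summand of lambert is local to its where block; it is recovered by
-- unifying with the definitional unfolding of lambert.
lambertStep : ℕ → ℕ → ℕ → ℤ → ℤ
lambertStep N m = summand {ys = range 1 N} (refl {x = lambert N m})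
  where
  summand : ∀ {F : ℕ → ℤ → ℤ} {ys : List ℕ} {r : ℤ} → foldr F (+ 0) ys ≡ r → ℕ → ℤ → ℤ
  summand {F} _ = F

lambertStep-suc : ∀ N m d acc → lambertStep N (suc m) d acc ≡ dv d (suc m) + acc
lambertStep-suc N m d acc with d ∣? suc m
... | yes _ = refl
... | no _  = refl

lambert≡g : ∀ N r → lambert N r ≡ g (+ r) N
lambert≡g N zero    = ∑ₗ-zero (range 1 N) (λ _ → refl)
lambert≡g N (suc m) = trans (foldr-cong (lambertStep-suc N m) refl (range 1 N))
  (sym (length-filter (λ d → d ∣? suc m) (range 1 N)))

middleCoeff≡S : ∀ m → middleCoeff (suc m) ≡ S (suc m)
middleCoeff≡S m = begin
  middleCoeff n
    ≡⟨ sumℤ-range 1 n (λ N → ((λ k → invPochInf k - invPoch N k) ⊛ lambert N) n) ⟩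
  ∑[ c < n ] ((λ k → invPochInf k - invPoch (suc c) k) ⊛ lambert (suc c)) n
    -- the k = 0 term of the Cauchy product computes to 0, as p 0 = pLe N 0 = 1
    ≡⟨ ∑-cong n (λ c _ → trans (sumℤ-range 0 n (λ k → (invPochInf k - invPoch (suc c) k) * lambert (suc c) (n ∸ k)))
                               (ℤ.+-identityˡ (∑[ a < n ] (f (suc a) (suc c) * lambert (suc c) (m ∸ a))))) ⟩
  ∑[ c < n ] ∑[ a < n ] (f (suc a) (suc c) * lambert (suc c) (m ∸ a))
    ≡⟨ ∑-comm n n (λ c a → f (suc a) (suc c) * lambert (suc c) (m ∸ a)) ⟩
  ∑[ a < n ] ∑[ c < n ] (f (suc a) (suc c) * lambert (suc c) (m ∸ a))
    ≡⟨ ∑-cong n (λ a a<n → ∑-cong n (λ c _ → cong (f (suc a) (suc c) *_)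
         (trans (lambert≡g (suc c) (m ∸ a)) (cong (λ z → g z (suc c)) (pos-∸ a<n))))) ⟩
  ∑[ a < n ] ∑[ c < n ] (f (suc a) (suc c) * g (+ n - + suc a) (suc c))
    ≡⟨ S-unfold m ⟨
  S n ∎
  where
  n = suc m

twice-S : ∀ m → let n = suc m in + 2 * S n ≡ + 2 * p₂ n - + 2 * (+ n * + p n) - N₂ n
twice-S m = begin
  + 2 * S n
    ≡⟨ cong (+ 2 *_) (trans (S≡deficitSum m) (sym (∑-largest*length≡deficitSum m))) ⟩
  + 2 * ∑ₗ λs excess
    ≡⟨ *-distribˡ-∑ₗ (+ 2) λs excess ⟩
  ∑[ μ ∈ λs ] (+ 2 * excess μ)
    ≡⟨ ∑ₗ-cong λs (λ μ → polarise (+ largest μ) (+ length μ) (+ n)) ⟩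
  ∑[ μ ∈ λs ] ((length² μ + largest² μ) - (+ 2 * + n + rank² μ))
    ≡⟨ ∑ₗ-distrib-- λs (λ μ → length² μ + largest² μ) (λ μ → + 2 * + n + rank² μ) ⟩
  ∑[ μ ∈ λs ] (length² μ + largest² μ) - ∑[ μ ∈ λs ] (+ 2 * + n + rank² μ)
    ≡⟨ cong₂ _-_ (∑ₗ-distrib-+ λs length² largest²) (∑ₗ-distrib-+ λs (λ _ → + 2 * + n) rank²) ⟩
  (∑ₗ λs length² + ∑ₗ λs largest²) - (∑[ μ ∈ λs ] (+ 2 * + n) + ∑ₗ λs rank²)
    ≡⟨ cong₂ _-_ (sym (cong₂ _+_ (p₂≡∑length² n) (p₂≡∑largest² n))) (cong₂ _+_ (∑ₗ-const (+ 2 * + n) λs) (sym (N₂≡∑rank² n))) ⟩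
  (p₂ n + p₂ n) - ((+ 2 * + n) * + p n + N₂ n)
    ≡⟨ rearrange (p₂ n) (+ n) (+ p n) (N₂ n) ⟩
  + 2 * p₂ n - + 2 * (+ n * + p n) - N₂ n ∎
  where
  n = suc m
  λs = partitions n
  excess length² largest² rank² : List ℕ → ℤ
  excess μ = + largest μ * + length μ - + n
  length² μ = + length μ * + length μ
  largest² μ = + largest μ * + largest μ
  rank² μ = rank μ * rank μ
  polarise : ∀ L l k → + 2 * (L * l - k) ≡ (l * l + L * L) - (+ 2 * k + (L - l) * (L - l))
  polarise = solve-∀
  rearrange : ∀ q k c r → (q + q) - ((+ 2 * k) * c + r) ≡ + 2 * q - + 2 * (k * c) - r
  rearrange = solve-∀

theorem1p1 : (n : ℕ) → n ≥ 1 →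
    (middleCoeff n ≡ S n)
      × (+ 2 * S n ≡ + 2 * p₂ n - + 2 * (+ n * + p n) - N₂ n)
theorem1p1 (suc m) _ = middleCoeff≡S m , twice-S m
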